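{- Let $L\ge1$, $J\ge0$ be integers and $Q_{\ell,j}(x)$ ($0\le\ell\le L$, $0\le j\le J$) polynomials with nonnegative coefficients, and let $F^{[\ge k]}_{k_1,k_2}(x)$, $A_{k,i}(x)$, $\overline A_{k,i}(x)$, $\overline d_k$, $\underline d_k$ be as defined in the context. Then: (1) for $k\le k_1$: $F^{[\ge k]}_{k_1,k_1}(x)=1+\sum_{m=k}^{k_1}\overline A_{k_1,k_1-m}(x)F^{[\ge k]}_{m,k_1}(x)$; (2) for $k\le k_1<k_2$: $F^{[\ge k]}_{k_1,k_2}(x)=\sum_{m=k}^{k_1}\overline A_{k_1,k_1-m}(x)F^{[\ge k]}_{m,k_2}(x)+\sum_{m=k_1+1}^{k_2}A_{k_1,m-k_1}(x)F^{[\ge m]}_{m,k_2}(x)$; (3) for $k\le k_2<k_1$: $F^{[\ge k]}_{k_1,k_2}(x)=\sum_{m=k}^{k_1}\overline A_{k_1,k_1-m}(x)F^{[\ge k]}_{m,k_2}(x)$; (4) for $k\ge0$ and $0\le i\le\overline d_{\min(k,J)}$: \[ A_{k,i}(x)=\sum_{\substack{0\le\ell\le L,\,0\le j\le \min(k,J)\\ \ell-j=i}}xQ_{\ell,j}(x)+\sum_{i_1>i,\,i_2>i}\Big(\sum_{\substack{0\le\ell_1\le L,\,0\le j_1\le\min(k,J)\\ \ell_1-j_1=i_1}}xQ_{\ell_1,j_1}(x)\Big)F^{[\ge k+i+1]}_{k+i_1,k+i_2}(x)\Big(\sum_{\substack{0\le\ell_2\le L,\,0\le j_2\le\min(k+i_2,J)\\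 \ell_2-j_2=-(i_2-i)}}xQ_{\ell_2,j_2}(x)\Big); \] (5) for $k\ge0$ and $0\le i\le\underline d_{\min(k,J)}$: \[ \overline A_{k,i}(x)=\sum_{\substack{0\le\ell\le L,\,0\le j\le \min(k,J)\\ \ell-j=-i}}xQ_{\ell,j}(x)+\sum_{i_1>0,\,i_2>0}\Big(\sum_{\substack{0\le\ell_1\le L,\,0\le j_1\le\min(k,J)\\ \ell_1-j_1=i_1}}xQ_{\ell_1,j_1}(x)\Big)F^{[\ge k+1]}_{k+i_1,k+i_2}(x)\Big(\sum_{\substack{0\le\ell_2\le L,\,0\le j_2\le\min(k+i_2,J)\\ \ell_2-j_2=-(i+i_2)}}xQ_{\ell_2,j_2}(x)\Big). \]
   Context: Steps and paths: for each level $h\ge0$, the multiset $\mathcal S_h$ contains, for each triple $(\ell,j,r)$ with $0\le\ell\le L$, $0\le j\le\min(h,J)$, $r\ge0$, $[x^r]Q_{\ell,j}(x)\ne0$, one copy of the step $(1+r,\ell-j)$ with weight $[x^r]Q_{\ell,j}(x)$ (distinct triples give distinct copies). An allowed path from level $a$ to level $b$ of length $n$ is a sequence $s_1\cdots s_M$ ($M\ge0$) of step copies such that, with heights $h_0=a$ and $h_m$ the height after $m$ steps, each $s_m$ is taken from $\mathcal S_{h_{m-1}}$, $h_M=b$, and the horizontal components sum to $n$; its weight $w(p)$ is the product of step weights (empty path: weight 1, length 0, from $a$ to $a$). For $k\le\min(k_1,k_2)$, $F^{[\ge k]}_{k_1,k_2}(x)=\sum_p w(p)x^{\mathrm{length}(p)}$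 over allowed paths from level $k_1$ to level $k_2$ all of whose heights $h_0,\dots,h_M$ are $\ge k$. For $k,i\ge0$, $A_{k,i}(x)$ is the same sum over allowed paths with $M\ge1$ from level $k$ to level $k+i$ whose intermediate heights $h_1,\dots,h_{M-1}$ are all $>k+i$ (prime walks); for $0\le i\le k$, $\overline A_{k,i}(x)$ is the sum over allowed paths with $M\ge1$ from level $k$ to level $k-i$ whose intermediate heights $h_1,\dots,h_{M-1}$ are all $>k$ (reverse prime walks). For $0\le k\le J$: $\overline d_k=\max\{\ell-j:0\le\ell\le L,\ 0\le j\le k,\ Q_{\ell,j}\ne0\}$ and $\underline d_k=\max\{j-\ell:0\le\ell\le L,\ 0\le j\le k,\ Q_{\ell,j}\ne0\}$.
   Formalization: The polynomials $Q_{\ell,j}(x)$ have nonnegative rational coefficients. -}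

module Defs where

open import Data.Nat as ℕ using (ℕ; zero; suc; _∸_; _⊓_; _≤ᵇ_; _<ᵇ_; _≡ᵇ_)
open import Data.Fin using (Fin; toℕ)
open import Data.Bool using (Bool; true; false; _∧_; not; if_then_else_)
open import Data.List using (List; []; _∷_; map; concatMap; upTo; allFin; foldr)
open import Data.Bool.ListAction using (any)
open import Relation.Binary.PropositionalEquality using (_≡_)
open import Data.Maybe using (Maybe; just; nothing)
open import Data.Integer as ℤ using (ℤ; +_)
open import Data.Rational as ℚ using (ℚ; 0ℚ; 1ℚ)
open import Relation.Nullary.Decidable using (⌊_⌋)

Series : Set
Series = ℕ → ℚ

infix 4 _≈ₛ_
_≈ₛ_ : Series → Series → Set
f ≈ₛ g = ∀ n → f n ≡ g n

Σℚ : List ℚ → ℚ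
Σℚ = foldr ℚ._+_ 0ℚ

Πℚ : List ℚ → ℚ
Πℚ = foldr ℚ._*_ 1ℚ

infixl 6 _⊕_
infixl 7 _⊛_

_⊕_ : Series → Series → Series
(f ⊕ g) n = f n ℚ.+ g n

_⊛_ : Series → Series → Series
(f ⊛ g) n = Σℚ (map (λ a → f a ℚ.* g (n ∸ a)) (upTo (suc n)))

oneₛ : Series
oneₛ zero    = 1ℚ
oneₛ (suc _) = 0ℚ

ΣS : List ℕ → (ℕ → Series) → Series
ΣS xs f n = Σℚ (map (λ i → f i n) xs)

-- the integer interval [a, b] (empty if b < a)
range : ℕ → ℕ → List ℕ
range a b = map (a ℕ.+_) (upTo (suc b ∸ a))

maxℤ : List ℤ → Maybe ℤ
maxℤ []       = nothing
maxℤ (z ∷ zs) with maxℤ zs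
... | nothing = just z
... | just m  = just (z ℤ.⊔ m)

-- Everything below is relative to L, J and the family of polynomials
-- Q ℓ j (0 ≤ ℓ ≤ L, 0 ≤ j ≤ J), each given by its coefficient list
-- (coefficient of x^r at position r).
module Walks (L J : ℕ) (Q : Fin (suc L) → Fin (suc J) → List ℚ) where

  coef : Fin (suc L) → Fin (suc J) → ℕ → ℚ
  coef ℓ j r = go (Q ℓ j) r
    where
    go : List ℚ → ℕ → ℚ
    go []       _       = 0ℚ
    go (c ∷ cs) zero    = c
    go (c ∷ cs) (suc r) = go cs r

  isNonzero : ℚ → Bool
  isNonzero c = not ⌊ c ℚ.≟ 0ℚ ⌋

  polyNonzero : Fin (suc L) → Fin (suc J) → Bool
  polyNonzero ℓ j = any isNonzero (Q ℓ j)

  -- A step copy is identified by its triple (ℓ, j, r); it is the step (1+r, ℓ-j).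
  record Step : Set where
    constructor step
    field
      sℓ : Fin (suc L)
      sj : Fin (suc J)
      sr : ℕ
  open Step public

  inS : ℕ → Step → Bool
  inS h s = (toℕ (sj s) ≤ᵇ h) ∧ isNonzero (coef (sℓ s) (sj s) (sr s))

  -- height after taking step s from height h (j ≤ h, so no truncation occurs)
  next : ℕ → Step → ℕ
  next h s = (h ∸ toℕ (sj s)) ℕ.+ toℕ (sℓ s)

  Path : Set
  Path = List Step

  allowedFrom : ℕ → Path → Bool
  allowedFrom h []       = true
  allowedFrom h (s ∷ p)  = inS h s ∧ allowedFrom (next h s) p

  heights : ℕ → Path → List ℕ
  heights h []      = h ∷ []
  heights h (s ∷ p) = h ∷ heights (next h s) p

  endH : ℕ → Path → ℕ
  endH h []      = h
  endH h (s ∷ p) = endH (next h s) p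

  pathLength : Path → ℕ
  pathLength = foldr (λ s n → suc (sr s) ℕ.+ n) 0

  weight : Path → ℚ
  weight p = Πℚ (map (λ s → coef (sℓ s) (sj s) (sr s)) p)

  stepsBelow : ℕ → List Step
  stepsBelow n = concatMap (λ ℓ → concatMap (λ j → map (step ℓ j) (upTo n)) (allFin (suc J))) (allFin (suc L))

  seqs : ℕ → ℕ → List Path
  seqs zero    n = [] ∷ []
  seqs (suc M) n = concatMap (λ s → map (s ∷_) (seqs M n)) (stepsBelow n)

  -- every path of length n has M ≤ n steps, each with r < n; these candidates
  -- list every sequence of step copies of length n exactly once
  candidates : ℕ → List Path
  candidates n = concatMap (λ M → seqs M n) (upTo (suc n))

  pathSum : ℕ → ℕ → (List ℕ → Bool) → Series
  pathSum a b P n =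
    Σℚ (map (λ p → if allowedFrom a p ∧ (endH a p ≡ᵇ b) ∧ (pathLength p ≡ᵇ n) ∧ P (heights a p)
                     then weight p else 0ℚ)
            (candidates n))

  allB : (ℕ → Bool) → List ℕ → Bool
  allB f = foldr (λ h b → f h ∧ b) true

  dropLast : List ℕ → List ℕ
  dropLast []           = []
  dropLast (x ∷ [])     = []
  dropLast (x ∷ y ∷ xs) = x ∷ dropLast (y ∷ xs)

  intermediate : List ℕ → List ℕ
  intermediate []       = []
  intermediate (_ ∷ hs) = dropLast hs

  atLeastOneStep : List ℕ → Bool
  atLeastOneStep (_ ∷ _ ∷ _) = true
  atLeastOneStep _           = false

  F : ℕ → ℕ → ℕ → Series
  F k k₁ k₂ = pathSum k₁ k₂ (allB (λ h → k ≤ᵇ h))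

  A : ℕ → ℕ → Series
  A k i = pathSum k (k ℕ.+ i)
            (λ hs → atLeastOneStep hs ∧ allB (λ h → (k ℕ.+ i) <ᵇ h) (intermediate hs))

  -- Ā_{k,i} : reverse prime walks from k to k-i (only used with i ≤ k)
  Abar : ℕ → ℕ → Series
  Abar k i = pathSum k (k ∸ i)
            (λ hs → atLeastOneStep hs ∧ allB (λ h → k <ᵇ h) (intermediate hs))

  xQ : Fin (suc L) → Fin (suc J) → Series
  xQ ℓ j zero    = 0ℚ
  xQ ℓ j (suc n) = coef ℓ j n

  SQ : ℕ → (ℕ → ℕ → Bool) → Series
  SQ m cond n =
    Σℚ (concatMap (λ ℓ → map (λ j → if (toℕ j ≤ᵇ m) ∧ cond (toℕ ℓ) (toℕ j) then xQ ℓ j n else 0ℚ)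
                              (allFin (suc J)))
                  (allFin (suc L)))

  valuesOver : ℕ → (ℕ → ℕ → ℤ) → List ℤ
  valuesOver k f =
    concatMap (λ ℓ → concatMap (λ j → if (toℕ j ≤ᵇ k) ∧ polyNonzero ℓ j then f (toℕ ℓ) (toℕ j) ∷ [] else [])
                                (allFin (suc J)))
              (allFin (suc L))

  dOver : ℕ → Maybe ℤ
  dOver k = maxℤ (valuesOver k (λ ℓ j → + ℓ ℤ.- + j))

  dUnder : ℕ → Maybe ℤ
  dUnder k = maxℤ (valuesOver k (λ ℓ j → + j ℤ.- + ℓ))

{-# OPTIONS --safe #-}
-- Every series in the statement is the length generating function n ↦ Σ_{|p| = n} f p of a
-- function f on step sequences, and ⊕, ΣS and ⊛ are the generating functions of the pointwise
-- sum, of the finite sum, and of the sum over all ways of cutting a sequence in two (the last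
-- by induction on the length, peeling off the first step).  Each identity therefore reduces to
-- an identity between functions on step sequences, checked sequence by sequence.
--
-- (1)–(3): a nonempty walk from k₁ staying ≥ k either returns to some level m ≤ k₁, and is cut
-- at the first such return into a reverse prime walk and a walk from m staying ≥ k; or it stays
-- above k₁, and is cut at the first visit of its lowest level m into a prime walk and a walk
-- from m staying ≥ m.
-- (4)–(5): a prime walk is a single step, or a first step up to some k + i₁, a walk staying
-- above the prime level, and a last step down from some k + i₂; the constraints on (ℓ, j) in
-- the sums of x·Q_{ℓ,j} are the arithmetic of these steps.
module Submission where

open import Defs
open import Data.Nat using (ℕ; suc; _+_; _∸_; _⊓_; _≤_; _<_)
open import Data.Fin using (Fin)
open import Data.List using (List)
open import Data.List.Relation.Unary.All using (All)
open import Data.Maybe using (just)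
open import Data.Product using (_×_; ∃)
open import Data.Integer as ℤ using (+_)
open import Data.Rational as ℚ using (ℚ; 0ℚ)
open import Relation.Binary.PropositionalEquality using (_≡_)

open import Algebra.Bundles using (CommutativeMonoid)
import Algebra.Properties.CommutativeSemigroup as CommutativeSemigroupProperties
open import Data.Bool using (Bool; true; false; _∧_; not; if_then_else_; T)
import Data.Bool.Properties as Boolₚ
open import Data.Empty using (⊥; ⊥-elim)
open import Data.Fin using (toℕ)
import Data.Fin.Properties as Finₚ
import Data.Integer.Properties as ℤₚ
open import Data.List using ([]; _∷_; map; concatMap; upTo; allFin; _++_)
import Data.List.Properties as Listₚ
open import Data.List.Relation.Unary.All using ([]; _∷_; universal)
open import Data.List.Relation.Unary.All.Properties using (concat⁺; map⁺)
open import Data.Maybe using (nothing)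
open import Data.Nat using (zero; z≤n; s≤s; _≤ᵇ_; _<ᵇ_; _≡ᵇ_)
open import Data.Nat.Induction using (<-rec)
import Data.Nat.Properties as ℕₚ
open import Data.Nat.Solver using (module +-*-Solver)
open import Data.Product using (_,_; proj₁; proj₂)
open import Data.Rational using (1ℚ) renaming (_+_ to _+ℚ_; _*_ to _*ℚ_)
import Data.Rational.Properties as ℚₚ
open import Data.Sum using (inj₁; inj₂)
open import Data.Unit using (tt)
open import Function using (_∘_; id; Equivalence)
open import Relation.Binary.PropositionalEquality
  using (refl; sym; trans; cong; cong₂; subst; subst₂; module ≡-Reasoning)
open import Relation.Nullary using (yes; no)

T⇒≡true : ∀ {b} → T b → b ≡ true
T⇒≡true = Equivalence.to Boolₚ.T-≡

¬T⇒≡false : ∀ {b} → (T b → ⊥) → b ≡ false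
¬T⇒≡false {true}  ¬b = ⊥-elim (¬b tt)
¬T⇒≡false {false} ¬b = refl

T-ext : ∀ {a b} → (T a → T b) → (T b → T a) → a ≡ b
T-ext {true}  {true}  _   _   = refl
T-ext {true}  {false} a⇒b _   = ⊥-elim (a⇒b tt)
T-ext {false} {true}  _   b⇒a = ⊥-elim (b⇒a tt)
T-ext {false} {false} _   _   = refl

T-∧⁺ : ∀ {a b} → T a → T b → T (a ∧ b)
T-∧⁺ ta tb = Equivalence.from Boolₚ.T-∧ (ta , tb)

T-∧⁻ : ∀ a {b} → T (a ∧ b) → T a × T b
T-∧⁻ a = Equivalence.to Boolₚ.T-∧

T-∧⁻³ : ∀ a b {c} → T (a ∧ b ∧ c) → T a × T b × T c
T-∧⁻³ a b t = let (ta , tbc) = T-∧⁻ a t in ta , T-∧⁻ b tbc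

≤ᵇ-suc : ∀ a n → (a ≤ᵇ n) ≡ (suc a ≤ᵇ suc n)
≤ᵇ-suc zero    n = refl
≤ᵇ-suc (suc a) n = refl

≡ᵇ-sym : ∀ m n → (m ≡ᵇ n) ≡ (n ≡ᵇ m)
≡ᵇ-sym m n = T-ext (λ m≡n → ℕₚ.≡⇒≡ᵇ n m (sym (ℕₚ.≡ᵇ⇒≡ m n m≡n)))
                   (λ n≡m → ℕₚ.≡⇒≡ᵇ m n (sym (ℕₚ.≡ᵇ⇒≡ n m n≡m)))

≡ᵇ-+ʳ : ∀ a x i → (x ≡ᵇ a + i) ≡ ((a ≤ᵇ x) ∧ (x ∸ a ≡ᵇ i))
≡ᵇ-+ʳ a x i = T-ext
  (λ x≡a+i → let a+i≡x = sym (ℕₚ.≡ᵇ⇒≡ x (a + i) x≡a+i) in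
    T-∧⁺ (ℕₚ.≤⇒≤ᵇ (subst (a ≤_) a+i≡x (ℕₚ.m≤m+n a i)))
         (ℕₚ.≡⇒≡ᵇ (x ∸ a) i (trans (cong (_∸ a) (sym a+i≡x)) (ℕₚ.m+n∸m≡n a i))))
  (λ h → let (a≤x , x∸a≡i) = T-∧⁻ (a ≤ᵇ x) h in
    ℕₚ.≡⇒≡ᵇ x (a + i) (trans (sym (ℕₚ.m+[n∸m]≡n (ℕₚ.≤ᵇ⇒≤ a x a≤x)))
                             (cong (_+_ a) (ℕₚ.≡ᵇ⇒≡ (x ∸ a) i x∸a≡i))))

infixr 8 [_]·_
[_]·_ : Bool → ℚ → ℚ
[ b ]· x = if b then x else 0ℚ

[]·-0 : ∀ b → [ b ]· 0ℚ ≡ 0ℚ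
[]·-0 true  = refl
[]·-0 false = refl

[]·-+ : ∀ b x y → [ b ]· (x +ℚ y) ≡ [ b ]· x +ℚ [ b ]· y
[]·-+ true  x y = refl
[]·-+ false x y = sym (ℚₚ.+-identityˡ 0ℚ)

[]·-*ˡ : ∀ b x y → [ b ]· (x *ℚ y) ≡ x *ℚ [ b ]· y
[]·-*ˡ true  x y = refl
[]·-*ˡ false x y = sym (ℚₚ.*-zeroʳ x)

[]·-*ʳ : ∀ b x y → [ b ]· (x *ℚ y) ≡ ([ b ]· x) *ℚ y
[]·-*ʳ true  x y = refl
[]·-*ʳ false x y = sym (ℚₚ.*-zeroˡ y)

[]·-∧ : ∀ a b x → [ a ∧ b ]· x ≡ [ a ]· [ b ]· x
[]·-∧ true  b x = refl
[]·-∧ false b x = refl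

[]·-comm : ∀ a b x → [ a ]· [ b ]· x ≡ [ b ]· [ a ]· x
[]·-comm true  b x = refl
[]·-comm false b x = sym ([]·-0 b)

[]·-cong : ∀ b {x y} → (T b → x ≡ y) → [ b ]· x ≡ [ b ]· y
[]·-cong true  x≡y = x≡y tt
[]·-cong false x≡y = refl

[]·-cong₂ : ∀ {a b x y} → a ≡ b → (T b → x ≡ y) → [ a ]· x ≡ [ b ]· y
[]·-cong₂ {a} refl x≡y = []·-cong a x≡y

[]·-zero : ∀ b {x} → (T b → x ≡ 0ℚ) → [ b ]· x ≡ 0ℚ
[]·-zero true  x≡0 = x≡0 tt
[]·-zero false x≡0 = refl

[]·-true : ∀ {b} x → T b → [ b ]· x ≡ x
[]·-true {true} x _ = refl

[]·-false : ∀ {b} x → (T b → ⊥) → [ b ]· x ≡ 0ℚ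
[]·-false {true}  x ¬b = ⊥-elim (¬b tt)
[]·-false {false} x ¬b = refl

[]·-absorb : ∀ a b x → (T b → T a) → [ a ]· [ b ]· x ≡ [ b ]· x
[]·-absorb a true  x b⇒a rewrite T⇒≡true (b⇒a tt) = refl
[]·-absorb a false x b⇒a = []·-0 a

+-interchange : ∀ a b c d → (a +ℚ b) +ℚ (c +ℚ d) ≡ (a +ℚ c) +ℚ (b +ℚ d)
+-interchange = CommutativeSemigroupProperties.interchange
  (CommutativeMonoid.commutativeSemigroup ℚₚ.+-0-commutativeMonoid)

-- Finite sums

private
  variable
    U V : Set

-- Opaque, so that lemmas about ∑ apply by unification rather than by unfolding foldr.
opaque
  ∑ : List U → (U → ℚ) → ℚ
  ∑ xs f = Σℚ (map f xs)
  infixr 6.5 ∑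
  syntax ∑ xs (λ x → e) = ∑[ x ← xs ] e

opaque
  unfolding ∑

  ∑-definition : ∀ (xs : List U) f → Σℚ (map f xs) ≡ ∑ xs f
  ∑-definition xs f = refl

  ∑-[] : ∀ (f : U → ℚ) → ∑ [] f ≡ 0ℚ
  ∑-[] f = refl

  ∑-singleton : ∀ (x : U) f → ∑ (x ∷ []) f ≡ f x
  ∑-singleton x f = ℚₚ.+-identityʳ (f x)

  ∑-cong : ∀ (xs : List U) {f g : U → ℚ} → (∀ x → f x ≡ g x) → ∑ xs f ≡ ∑ xs g
  ∑-cong []       f≗g = refl
  ∑-cong (x ∷ xs) f≗g = cong₂ _+ℚ_ (f≗g x) (∑-cong xs f≗g)

  ∑-zero : ∀ (xs : List U) {f : U → ℚ} → (∀ x → f x ≡ 0ℚ) → ∑ xs f ≡ 0ℚ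
  ∑-zero []       f≗0 = refl
  ∑-zero (x ∷ xs) f≗0 = trans (cong₂ _+ℚ_ (f≗0 x) (∑-zero xs f≗0)) (ℚₚ.+-identityˡ 0ℚ)

  ∑-+ : ∀ (xs : List U) (f g : U → ℚ) → ∑[ x ← xs ] (f x +ℚ g x) ≡ ∑ xs f +ℚ ∑ xs g
  ∑-+ []       f g = sym (ℚₚ.+-identityˡ 0ℚ)
  ∑-+ (x ∷ xs) f g = begin
    (f x +ℚ g x) +ℚ (∑[ x ← xs ] (f x +ℚ g x))  ≡⟨ cong ((f x +ℚ g x) +ℚ_) (∑-+ xs f g) ⟩
    (f x +ℚ g x) +ℚ (∑ xs f +ℚ ∑ xs g)        ≡⟨ +-interchange (f x) (g x) (∑ xs f) (∑ xs g) ⟩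
    (f x +ℚ ∑ xs f) +ℚ (g x +ℚ ∑ xs g)        ∎
    where open ≡-Reasoning

  ∑-*ˡ : ∀ (xs : List U) c (f : U → ℚ) → ∑[ x ← xs ] (c *ℚ f x) ≡ c *ℚ ∑ xs f
  ∑-*ˡ []       c f = sym (ℚₚ.*-zeroʳ c)
  ∑-*ˡ (x ∷ xs) c f = trans (cong (c *ℚ f x +ℚ_) (∑-*ˡ xs c f)) (sym (ℚₚ.*-distribˡ-+ c (f x) _))

  ∑-*ʳ : ∀ (xs : List U) c (f : U → ℚ) → ∑[ x ← xs ] (f x *ℚ c) ≡ ∑ xs f *ℚ c
  ∑-*ʳ []       c f = sym (ℚₚ.*-zeroˡ c)
  ∑-*ʳ (x ∷ xs) c f = trans (cong (f x *ℚ c +ℚ_) (∑-*ʳ xs c f)) (sym (ℚₚ.*-distribʳ-+ c (f x) _))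

  ∑-[]· : ∀ (xs : List U) b (f : U → ℚ) → ∑[ x ← xs ] [ b ]· f x ≡ [ b ]· ∑ xs f
  ∑-[]· xs true  f = refl
  ∑-[]· xs false f = ∑-zero xs (λ _ → refl)

  ∑-++ : ∀ (xs ys : List U) (f : U → ℚ) → ∑ (xs ++ ys) f ≡ ∑ xs f +ℚ ∑ ys f
  ∑-++ []       ys f = sym (ℚₚ.+-identityˡ _)
  ∑-++ (x ∷ xs) ys f = trans (cong (f x +ℚ_) (∑-++ xs ys f)) (sym (ℚₚ.+-assoc (f x) _ _))

  ∑-swap : ∀ (xs : List U) (ys : List V) (f : U → V → ℚ) →
           ∑[ x ← xs ] ∑ ys (f x) ≡ ∑[ y ← ys ] ∑[ x ← xs ] f x y
  ∑-swap []       ys f = sym (∑-zero ys (λ _ → refl))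
  ∑-swap (x ∷ xs) ys f = trans (cong (∑ ys (f x) +ℚ_) (∑-swap xs ys f)) (sym (∑-+ ys (f x) _))

  ∑-map : ∀ (g : U → V) (xs : List U) (f : V → ℚ) → ∑ (map g xs) f ≡ ∑ xs (f ∘ g)
  ∑-map g xs f = cong Σℚ (sym (Listₚ.map-∘ xs))

  ∑-concatMap : ∀ (g : U → List V) (xs : List U) (f : V → ℚ) →
                ∑ (concatMap g xs) f ≡ ∑[ x ← xs ] ∑ (g x) f
  ∑-concatMap g []       f = refl
  ∑-concatMap g (x ∷ xs) f =
    trans (∑-++ (g x) (concatMap g xs) f) (cong (∑ (g x) f +ℚ_) (∑-concatMap g xs f))

  Σℚ-concatMap-map : ∀ (xs : List U) (ys : List V) (h : U → V → ℚ) →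
    Σℚ (concatMap (λ x → map (h x) ys) xs) ≡ ∑[ x ← xs ] ∑ ys (h x)
  Σℚ-concatMap-map xs ys h =
    trans (cong Σℚ (sym (Listₚ.map-id (concatMap (λ x → map (h x) ys) xs))))
    (trans (∑-concatMap _ xs id) (∑-cong xs λ x → ∑-map (h x) ys id))

  ∑-upTo-suc : ∀ n (f : ℕ → ℚ) → ∑ (upTo (suc n)) f ≡ f 0 +ℚ ∑ (upTo n) (f ∘ suc)
  ∑-upTo-suc n f = cong (λ xs → f 0 +ℚ Σℚ xs)
    (trans (Listₚ.map-applyUpTo suc f n) (sym (Listₚ.map-applyUpTo id (f ∘ suc) n)))

  ∑-upTo-last : ∀ n (f : ℕ → ℚ) → ∑[ r ← upTo (suc n) ] [ 0 ≡ᵇ n ∸ r ]· f r ≡ f n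
  ∑-upTo-last zero    f = ℚₚ.+-identityʳ (f 0)
  ∑-upTo-last (suc n) f = trans (∑-upTo-suc (suc n) (λ r → [ 0 ≡ᵇ suc n ∸ r ]· f r))
                                (trans (ℚₚ.+-identityˡ _) (∑-upTo-last n (f ∘ suc)))

  ∑-upTo-cong : ∀ n {f g : ℕ → ℚ} → (∀ r → r < n → f r ≡ g r) → ∑ (upTo n) f ≡ ∑ (upTo n) g
  ∑-upTo-cong zero    f≗g = refl
  ∑-upTo-cong (suc n) {f} {g} f≗g = begin
    ∑ (upTo (suc n)) f           ≡⟨ ∑-upTo-suc n f ⟩
    f 0 +ℚ ∑ (upTo n) (f ∘ suc)  ≡⟨ cong₂ _+ℚ_ (f≗g 0 (s≤s z≤n))
                                              (∑-upTo-cong n (λ r r<n → f≗g (suc r) (s≤s r<n))) ⟩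
    g 0 +ℚ ∑ (upTo n) (g ∘ suc)  ≡⟨ sym (∑-upTo-suc n g) ⟩
    ∑ (upTo (suc n)) g           ∎
    where open ≡-Reasoning

  ∑-upTo-tail-zero : ∀ {n c} (f : ℕ → ℚ) → n ≤ c → (∀ r → n ≤ r → f r ≡ 0ℚ) →
                     ∑ (upTo c) f ≡ ∑ (upTo n) f
  ∑-upTo-tail-zero {zero}  {zero}  f _ _ = refl
  ∑-upTo-tail-zero {zero}  {suc c} f _ f≗0 = trans (∑-upTo-suc c f) (trans
    (cong₂ _+ℚ_ (f≗0 0 z≤n) (∑-upTo-tail-zero {c = c} (f ∘ suc) z≤n (λ r _ → f≗0 (suc r) z≤n)))
    (ℚₚ.+-identityˡ 0ℚ))
  ∑-upTo-tail-zero {suc n} {suc c} f (s≤s n≤c) f≗0 = trans (∑-upTo-suc c f) (trans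
    (cong (f 0 +ℚ_) (∑-upTo-tail-zero (f ∘ suc) n≤c (λ r n≤r → f≗0 (suc r) (s≤s n≤r))))
    (sym (∑-upTo-suc n f)))

  ∑-upTo-point : ∀ n x (f : ℕ → ℚ) → ∑[ m ← upTo n ] [ x ≡ᵇ m ]· f m ≡ [ x <ᵇ n ]· f x
  ∑-upTo-point zero    x       f = sym ([]·-0 (x <ᵇ 0))
  ∑-upTo-point (suc n) zero    f = trans (∑-upTo-suc n (λ m → [ 0 ≡ᵇ m ]· f m))
    (trans (cong (f 0 +ℚ_) (∑-zero (upTo n) (λ _ → refl))) (ℚₚ.+-identityʳ (f 0)))
  ∑-upTo-point (suc n) (suc x) f = trans (∑-upTo-suc n (λ m → [ suc x ≡ᵇ m ]· f m))
    (trans (ℚₚ.+-identityˡ _) (∑-upTo-point n x (f ∘ suc)))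

  ∑-upTo-triangle : ∀ n (φ : ℕ → ℕ → ℚ) →
    ∑[ a ← upTo (suc n) ] ∑ (upTo a) (φ a) ≡ ∑[ r ← upTo n ] ∑[ a ← upTo (n ∸ r) ] φ (suc r + a) r
  ∑-upTo-triangle zero    φ = ℚₚ.+-identityˡ 0ℚ
  ∑-upTo-triangle (suc n) φ = begin
    ∑[ a ← upTo (suc (suc n)) ] ∑ (upTo a) (φ a)
      ≡⟨ trans (∑-upTo-suc (suc n) (λ a → ∑ (upTo a) (φ a))) (ℚₚ.+-identityˡ _) ⟩
    ∑[ a ← upTo (suc n) ] ∑ (upTo (suc a)) (φ (suc a))
      ≡⟨ ∑-cong (upTo (suc n)) (λ a → ∑-upTo-suc a (φ (suc a))) ⟩
    ∑[ a ← upTo (suc n) ] (φ (suc a) 0 +ℚ ∑[ r ← upTo a ] φ (suc a) (suc r))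
      ≡⟨ ∑-+ (upTo (suc n)) (λ a → φ (suc a) 0) (λ a → ∑[ r ← upTo a ] φ (suc a) (suc r)) ⟩
    ∑[ a ← upTo (suc n) ] φ (suc a) 0 +ℚ ∑[ a ← upTo (suc n) ] ∑[ r ← upTo a ] φ (suc a) (suc r)
      ≡⟨ cong (∑[ a ← upTo (suc n) ] φ (suc a) 0 +ℚ_) (∑-upTo-triangle n (λ a r → φ (suc a) (suc r))) ⟩
    ∑[ a ← upTo (suc n) ] φ (suc a) 0 +ℚ ∑[ r ← upTo n ] ∑[ a ← upTo (n ∸ r) ] φ (suc (suc r + a)) (suc r)
      ≡⟨ sym (∑-upTo-suc n (λ r → ∑[ a ← upTo (suc n ∸ r) ] φ (suc r + a) r)) ⟩
    ∑[ r ← upTo (suc n) ] ∑[ a ← upTo (suc n ∸ r) ] φ (suc r + a) r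
      ∎
    where open ≡-Reasoning

  ∑-range : ∀ lo hi (f : ℕ → ℚ) → ∑ (range lo hi) f ≡ ∑[ m ← upTo (suc hi) ] [ lo ≤ᵇ m ]· f m
  ∑-range zero     hi       f = ∑-map (_+_ 0) (upTo (suc hi)) f
  ∑-range (suc lo) zero     f rewrite ℕₚ.0∸n≡0 lo = refl
  ∑-range (suc lo) (suc hi) f = begin
    ∑ (range (suc lo) (suc hi)) f
      ≡⟨ ∑-map (_+_ (suc lo)) (upTo (suc hi ∸ lo)) f ⟩
    ∑[ t ← upTo (suc hi ∸ lo) ] f (suc lo + t)
      ≡⟨ sym (∑-map (_+_ lo) (upTo (suc hi ∸ lo)) (f ∘ suc)) ⟩
    ∑ (range lo hi) (f ∘ suc)
      ≡⟨ ∑-range lo hi (f ∘ suc) ⟩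
    ∑[ m ← upTo (suc hi) ] [ lo ≤ᵇ m ]· f (suc m)
      ≡⟨ ∑-cong (upTo (suc hi)) (λ m → cong ([_]· f (suc m)) (≤ᵇ-suc lo m)) ⟩
    ∑[ m ← upTo (suc hi) ] [ suc lo ≤ᵇ suc m ]· f (suc m)
      ≡⟨ sym (trans (∑-upTo-suc (suc hi) (λ m → [ suc lo ≤ᵇ m ]· f m)) (ℚₚ.+-identityˡ _)) ⟩
    ∑[ m ← upTo (suc (suc hi)) ] [ suc lo ≤ᵇ m ]· f m
      ∎
    where open ≡-Reasoning

∑-range-from : ∀ lo hi (f : ℕ → ℚ) → (∀ m → m < lo → f m ≡ 0ℚ) →
               ∑ (range lo hi) f ≡ ∑ (upTo (suc hi)) f
∑-range-from lo hi f below≗0 = trans (∑-range lo hi f) (∑-cong (upTo (suc hi)) drop-guard)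
  where
  drop-guard : ∀ m → [ lo ≤ᵇ m ]· f m ≡ f m
  drop-guard m with lo ≤ᵇ m in lo≤m
  ... | true  = refl
  ... | false = sym (below≗0 m (ℕₚ.≰⇒> λ lo≤m′ → subst T lo≤m (ℕₚ.≤⇒≤ᵇ lo≤m′)))

range-empty : ∀ {lo hi} → hi < lo → range lo hi ≡ []
range-empty {lo} {hi} hi<lo = cong (λ n → map (_+_ lo) (upTo n)) (ℕₚ.m≤n⇒m∸n≡0 hi<lo)

∑-guard-split : ∀ (xs : List ℕ) (a b : ℕ → Bool) (f : ℕ → ℚ) → (∀ x → T (a x) → T (b x)) →
  ∑[ x ← xs ] [ b x ]· f x ≡ ∑[ x ← xs ] [ a x ]· f x +ℚ ∑[ x ← xs ] [ b x ∧ not (a x) ]· f x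
∑-guard-split xs a b f a⇒b = trans (∑-cong xs λ x → split (a x) (b x) (f x) (a⇒b x)) (∑-+ xs _ _)
  where
  split : ∀ α β y → (T α → T β) → [ β ]· y ≡ [ α ]· y +ℚ [ β ∧ not α ]· y
  split true  β     y α⇒β rewrite T⇒≡true (α⇒β tt) = sym (ℚₚ.+-identityʳ y)
  split false true  y _ = sym (ℚₚ.+-identityˡ y)
  split false false y _ = sym (ℚₚ.+-identityˡ 0ℚ)

∑-range-point : ∀ lo hi x (f : ℕ → ℚ) →
  ∑[ m ← range lo hi ] [ x ≡ᵇ m ]· f m ≡ [ (lo ≤ᵇ x) ∧ (x <ᵇ suc hi) ]· f x
∑-range-point lo hi x f = begin
  ∑[ m ← range lo hi ] [ x ≡ᵇ m ]· f m
    ≡⟨ ∑-range lo hi _ ⟩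
  ∑[ m ← upTo (suc hi) ] [ lo ≤ᵇ m ]· [ x ≡ᵇ m ]· f m
    ≡⟨ ∑-cong (upTo (suc hi)) (λ m → []·-comm (lo ≤ᵇ m) (x ≡ᵇ m) (f m)) ⟩
  ∑[ m ← upTo (suc hi) ] [ x ≡ᵇ m ]· [ lo ≤ᵇ m ]· f m
    ≡⟨ ∑-upTo-point (suc hi) x (λ m → [ lo ≤ᵇ m ]· f m) ⟩
  [ x <ᵇ suc hi ]· [ lo ≤ᵇ x ]· f x
    ≡⟨ trans ([]·-comm (x <ᵇ suc hi) (lo ≤ᵇ x) (f x)) (sym ([]·-∧ (lo ≤ᵇ x) (x <ᵇ suc hi) (f x))) ⟩
  [ (lo ≤ᵇ x) ∧ (x <ᵇ suc hi) ]· f x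
    ∎
  where open ≡-Reasoning

∑-range-shift : ∀ lo hi a x (f : ℕ → ℚ) →
  ∑[ i ← range lo hi ] [ x ≡ᵇ a + i ]· f i
    ≡ [ a ≤ᵇ x ]· [ (lo ≤ᵇ x ∸ a) ∧ (x ∸ a <ᵇ suc hi) ]· f (x ∸ a)
∑-range-shift lo hi a x f = begin
  ∑[ i ← range lo hi ] [ x ≡ᵇ a + i ]· f i
    ≡⟨ ∑-cong (range lo hi) (λ i → trans (cong ([_]· f i) (≡ᵇ-+ʳ a x i)) ([]·-∧ (a ≤ᵇ x) _ (f i))) ⟩
  ∑[ i ← range lo hi ] [ a ≤ᵇ x ]· [ x ∸ a ≡ᵇ i ]· f i
    ≡⟨ ∑-[]· (range lo hi) (a ≤ᵇ x) _ ⟩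
  [ a ≤ᵇ x ]· (∑[ i ← range lo hi ] [ x ∸ a ≡ᵇ i ]· f i)
    ≡⟨ cong ([ a ≤ᵇ x ]·_) (∑-range-point lo hi (x ∸ a) f) ⟩
  [ a ≤ᵇ x ]· [ (lo ≤ᵇ x ∸ a) ∧ (x ∸ a <ᵇ suc hi) ]· f (x ∸ a)
    ∎
  where open ≡-Reasoning

-- Arithmetic of a single step

∸+-cancel : ∀ {h j} ℓ → j ≤ h → (h ∸ j + ℓ) + j ≡ h + ℓ
∸+-cancel {h} {j} ℓ j≤h = begin
  (h ∸ j + ℓ) + j  ≡⟨ ℕₚ.+-assoc (h ∸ j) ℓ j ⟩
  h ∸ j + (ℓ + j)  ≡⟨ cong (_+_ (h ∸ j)) (ℕₚ.+-comm ℓ j) ⟩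
  h ∸ j + (j + ℓ)  ≡⟨ sym (ℕₚ.+-assoc (h ∸ j) j ℓ) ⟩
  (h ∸ j + j) + ℓ  ≡⟨ cong (_+ ℓ) (ℕₚ.m∸n+n≡m j≤h) ⟩
  h + ℓ            ∎
  where open ≡-Reasoning

∸+≡⇒ : ∀ {h j ℓ u} → j ≤ h → h ∸ j + ℓ ≡ u → h + ℓ ≡ u + j
∸+≡⇒ {h} {j} {ℓ} j≤h eq = trans (sym (∸+-cancel ℓ j≤h)) (cong (_+ j) eq)

∸+≡⇐ : ∀ {h j ℓ u} → j ≤ h → h + ℓ ≡ u + j → h ∸ j + ℓ ≡ u
∸+≡⇐ {h} {j} {ℓ} {u} j≤h eq = ℕₚ.+-cancelʳ-≡ j (h ∸ j + ℓ) u (trans (∸+-cancel ℓ j≤h) eq)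

module _ {e j ℓ base δ : ℕ} (j≤e : j ≤ e) (e+ℓ≡ : e + ℓ ≡ base + (ℓ + δ)) where

  lands⇒ : e ∸ j + ℓ ≡ base → j ≡ ℓ + δ
  lands⇒ lands = ℕₚ.+-cancelˡ-≡ base j (ℓ + δ) (trans (sym (∸+≡⇒ j≤e lands)) e+ℓ≡)

  lands⇐ : j ≡ ℓ + δ → e ∸ j + ℓ ≡ base
  lands⇐ j≡ = ∸+≡⇐ j≤e (trans e+ℓ≡ (cong (_+_ base) (sym j≡)))

maxℤ-≤ : ∀ B zs {d} → All (ℤ._≤ B) zs → maxℤ zs ≡ just d → d ℤ.≤ B
maxℤ-≤ B (z ∷ zs) (z≤B ∷ zs≤B) max≡d with maxℤ zs in max-zs
maxℤ-≤ B (z ∷ zs) (z≤B ∷ zs≤B) refl | nothing = z≤B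
maxℤ-≤ B (z ∷ zs) (z≤B ∷ zs≤B) refl | just m  = ℤₚ.⊔-lub z≤B (maxℤ-≤ B zs zs≤B max-zs)

module PathSums (L J : ℕ) (Q : Fin (suc L) → Fin (suc J) → List ℚ) where

  open Walks L J Q

  -- Sums over step sequences of a given length

  opaque
    ∑ₛ : ℕ → (Step → ℚ) → ℚ
    ∑ₛ c f = ∑[ ℓ ← allFin (suc L) ] ∑[ j ← allFin (suc J) ] ∑[ r ← upTo c ] f (step ℓ j r)

  opaque
    unfolding ∑ₛ

    ∑ₛ-definition : ∀ c (f : Step → ℚ) →
      ∑ₛ c f ≡ ∑[ ℓ ← allFin (suc L) ] ∑[ j ← allFin (suc J) ] ∑[ r ← upTo c ] f (step ℓ j r)
    ∑ₛ-definition c f = refl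

    ∑-stepsBelow : ∀ c (f : Step → ℚ) → ∑ (stepsBelow c) f ≡ ∑ₛ c f
    ∑-stepsBelow c f =
      trans (∑-concatMap _ (allFin (suc L)) f) (∑-cong (allFin (suc L)) λ ℓ →
      trans (∑-concatMap _ (allFin (suc J)) f) (∑-cong (allFin (suc J)) λ j →
      ∑-map (step ℓ j) (upTo c) f))

    ∑ₛ-cong : ∀ c {f g : Step → ℚ} → (∀ s → sr s < c → f s ≡ g s) → ∑ₛ c f ≡ ∑ₛ c g
    ∑ₛ-cong c f≗g = ∑-cong (allFin (suc L)) λ ℓ → ∑-cong (allFin (suc J)) λ j →
      ∑-upTo-cong c λ r r<c → f≗g (step ℓ j r) r<c

    ∑ₛ-zero : ∀ c {f : Step → ℚ} → (∀ s → f s ≡ 0ℚ) → ∑ₛ c f ≡ 0ℚ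
    ∑ₛ-zero c f≗0 = ∑-zero (allFin (suc L)) λ ℓ → ∑-zero (allFin (suc J)) λ j → ∑-zero (upTo c) λ r → f≗0 _

    ∑ₛ-+ : ∀ c (f g : Step → ℚ) → ∑ₛ c (λ s → f s +ℚ g s) ≡ ∑ₛ c f +ℚ ∑ₛ c g
    ∑ₛ-+ c f g = begin
      ∑ₛ c (λ s → f s +ℚ g s)                  ≡⟨ sym (∑-stepsBelow c _) ⟩
      ∑[ s ← stepsBelow c ] (f s +ℚ g s)        ≡⟨ ∑-+ (stepsBelow c) f g ⟩
      ∑ (stepsBelow c) f +ℚ ∑ (stepsBelow c) g  ≡⟨ cong₂ _+ℚ_ (∑-stepsBelow c f) (∑-stepsBelow c g) ⟩
      ∑ₛ c f +ℚ ∑ₛ c g                          ∎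
      where open ≡-Reasoning

    ∑-∑ₛ-swap : ∀ (xs : List U) c (f : U → Step → ℚ) →
                ∑[ x ← xs ] ∑ₛ c (f x) ≡ ∑ₛ c (λ s → ∑[ x ← xs ] f x s)
    ∑-∑ₛ-swap xs c f = begin
      ∑[ x ← xs ] ∑ₛ c (f x)                 ≡⟨ ∑-cong xs (λ x → sym (∑-stepsBelow c (f x))) ⟩
      ∑[ x ← xs ] ∑ (stepsBelow c) (f x)     ≡⟨ ∑-swap xs (stepsBelow c) f ⟩
      ∑[ s ← stepsBelow c ] ∑[ x ← xs ] f x s ≡⟨ ∑-stepsBelow c _ ⟩
      ∑ₛ c (λ s → ∑[ x ← xs ] f x s)          ∎
      where open ≡-Reasoning

    ∑ₛ-shrink : ∀ {n c} (f : Step → ℚ) → n ≤ c →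
                ∑ₛ c (λ s → [ suc (sr s) ≤ᵇ n ]· f s) ≡ ∑ₛ n (λ s → [ suc (sr s) ≤ᵇ n ]· f s)
    ∑ₛ-shrink {n} f n≤c = ∑-cong (allFin (suc L)) λ ℓ → ∑-cong (allFin (suc J)) λ j →
      ∑-upTo-tail-zero _ n≤c λ r n≤r → []·-false _ (λ r<n → ℕₚ.<⇒≱ (ℕₚ.≤ᵇ⇒≤ (suc r) n r<n) n≤r)

    ∑ₛ-triangle : ∀ n (φ : ℕ → Step → ℚ) →
      ∑[ a ← upTo (suc n) ] ∑ₛ a (φ a) ≡ ∑ₛ n (λ s → ∑[ a ← upTo (n ∸ sr s) ] φ (suc (sr s) + a) s)
    ∑ₛ-triangle n φ =
      trans (∑-swap (upTo (suc n)) (allFin (suc L))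
                    (λ a ℓ → ∑[ j ← allFin (suc J) ] ∑[ r ← upTo a ] φ a (step ℓ j r)))
        (∑-cong (allFin (suc L)) λ ℓ →
      trans (∑-swap (upTo (suc n)) (allFin (suc J)) (λ a j → ∑[ r ← upTo a ] φ a (step ℓ j r)))
        (∑-cong (allFin (suc J)) λ j →
      ∑-upTo-triangle n (λ a r → φ a (step ℓ j r))))

  opaque
    ∑ₚ : ℕ → (Path → ℚ) → ℚ
    ∑ₚ n g = ∑[ p ← candidates n ] [ pathLength p ≡ᵇ n ]· g p

  opaque
    unfolding ∑ₚ

    private
      ∑ₘ : ℕ → ℕ → ℕ → (Path → ℚ) → ℚ
      ∑ₘ M c n g = ∑[ p ← seqs M c ] [ pathLength p ≡ᵇ n ]· g p

      length-∷ : ∀ s p n x →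
        [ pathLength (s ∷ p) ≡ᵇ n ]· x ≡ [ suc (sr s) ≤ᵇ n ]· [ pathLength p ≡ᵇ n ∸ suc (sr s) ]· x
      length-∷ s p n x = go (suc (sr s)) n
        where
        go : ∀ a n → [ a + pathLength p ≡ᵇ n ]· x ≡ [ a ≤ᵇ n ]· [ pathLength p ≡ᵇ n ∸ a ]· x
        go zero          n       = refl
        go (suc zero)    zero    = refl
        go (suc (suc a)) zero    = refl
        go (suc a)       (suc n) = trans (go a n) (cong ([_]· [ pathLength p ≡ᵇ n ∸ a ]· x) (≤ᵇ-suc a n))

      ∑ₘ-suc : ∀ M c n g →
        ∑ₘ (suc M) c n g ≡ ∑ₛ c (λ s → [ suc (sr s) ≤ᵇ n ]· ∑ₘ M c (n ∸ suc (sr s)) (g ∘ (s ∷_)))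
      ∑ₘ-suc M c n g = begin
        ∑ₘ (suc M) c n g
          ≡⟨ ∑-concatMap _ (stepsBelow c) _ ⟩
        ∑[ s ← stepsBelow c ] ∑[ p ← map (s ∷_) (seqs M c) ] [ pathLength p ≡ᵇ n ]· g p
          ≡⟨ ∑-cong (stepsBelow c) (λ s → trans (∑-map (s ∷_) (seqs M c) _) (trans
               (∑-cong (seqs M c) (λ p → length-∷ s p n (g (s ∷ p))))
               (∑-[]· (seqs M c) _ _))) ⟩
        ∑[ s ← stepsBelow c ] [ suc (sr s) ≤ᵇ n ]· ∑ₘ M c (n ∸ suc (sr s)) (g ∘ (s ∷_))
          ≡⟨ ∑-stepsBelow c _ ⟩
        ∑ₛ c (λ s → [ suc (sr s) ≤ᵇ n ]· ∑ₘ M c (n ∸ suc (sr s)) (g ∘ (s ∷_)))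
          ∎
        where open ≡-Reasoning

      ∑ₘ-cutoff : ∀ M {c n} g → n ≤ c → ∑ₘ M c n g ≡ ∑ₘ M n n g
      ∑ₘ-cutoff zero    g n≤c = refl
      ∑ₘ-cutoff (suc M) {c} {n} g n≤c = begin
        ∑ₘ (suc M) c n g
          ≡⟨ ∑ₘ-suc M c n g ⟩
        ∑ₛ c (λ s → [ suc (sr s) ≤ᵇ n ]· ∑ₘ M c (rest s) (g ∘ (s ∷_)))
          ≡⟨ ∑ₛ-cong c (λ s _ → cong ([ suc (sr s) ≤ᵇ n ]·_)
                                     (∑ₘ-cutoff M _ (ℕₚ.≤-trans (rest≤n s) n≤c))) ⟩
        ∑ₛ c (λ s → [ suc (sr s) ≤ᵇ n ]· ∑ₘ M (rest s) (rest s) (g ∘ (s ∷_)))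
          ≡⟨ ∑ₛ-shrink _ n≤c ⟩
        ∑ₛ n (λ s → [ suc (sr s) ≤ᵇ n ]· ∑ₘ M (rest s) (rest s) (g ∘ (s ∷_)))
          ≡⟨ ∑ₛ-cong n (λ s _ → cong ([ suc (sr s) ≤ᵇ n ]·_) (sym (∑ₘ-cutoff M _ (rest≤n s)))) ⟩
        ∑ₛ n (λ s → [ suc (sr s) ≤ᵇ n ]· ∑ₘ M n (rest s) (g ∘ (s ∷_)))
          ≡⟨ sym (∑ₘ-suc M n n g) ⟩
        ∑ₘ (suc M) n n g
          ∎
        where
        open ≡-Reasoning
        rest : Step → ℕ
        rest s = n ∸ suc (sr s)
        rest≤n : ∀ s → rest s ≤ n
        rest≤n s = ℕₚ.m∸n≤m n (suc (sr s))

      ∑ₘ-tooMany : ∀ M c n g → n < M → ∑ₘ M c n g ≡ 0ℚ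
      ∑ₘ-tooMany (suc M) c n g (s≤s n≤M) = trans (∑ₘ-suc M c n g) (∑ₛ-zero c λ s →
        []·-zero (suc (sr s) ≤ᵇ n) λ r<n →
          ∑ₘ-tooMany M c _ _
            (ℕₚ.<-≤-trans (ℕₚ.∸-monoʳ-< (s≤s z≤n) (ℕₚ.≤ᵇ⇒≤ (suc (sr s)) n r<n)) n≤M))

      ∑ₚ-by-steps : ∀ n g → ∑ₚ n g ≡ ∑[ M ← upTo (suc n) ] ∑ₘ M n n g
      ∑ₚ-by-steps n g = ∑-concatMap (λ M → seqs M n) (upTo (suc n)) _

    ∑ₚ-unfold : ∀ n g →
      ∑ₚ n g ≡ [ 0 ≡ᵇ n ]· g [] +ℚ ∑ₛ n (λ s → ∑ₚ (n ∸ suc (sr s)) (g ∘ (s ∷_)))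
    ∑ₚ-unfold n g = begin
      ∑ₚ n g
        ≡⟨ trans (∑ₚ-by-steps n g) (∑-upTo-suc n _) ⟩
      ∑ₘ 0 n n g +ℚ ∑[ M ← upTo n ] ∑ₘ (suc M) n n g
        ≡⟨ cong₂ _+ℚ_ (∑-singleton [] _)
                      (∑-cong (upTo n) (λ M → ∑ₘ-suc M n n g)) ⟩
      [ 0 ≡ᵇ n ]· g []
        +ℚ ∑[ M ← upTo n ] ∑ₛ n (λ s → [ suc (sr s) ≤ᵇ n ]· ∑ₘ M n (rest s) (g ∘ (s ∷_)))
        ≡⟨ cong ([ 0 ≡ᵇ n ]· g [] +ℚ_) (trans (∑-∑ₛ-swap (upTo n) n _) (∑ₛ-cong n λ s r<n →
             trans (∑-[]· (upTo n) _ _) ([]·-true _ (ℕₚ.≤⇒≤ᵇ r<n)))) ⟩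
      [ 0 ≡ᵇ n ]· g [] +ℚ ∑ₛ n (λ s → ∑[ M ← upTo n ] ∑ₘ M n (rest s) (g ∘ (s ∷_)))
        ≡⟨ cong ([ 0 ≡ᵇ n ]· g [] +ℚ_) (∑ₛ-cong n λ s r<n →
             trans (tail-sum s r<n) (sym (∑ₚ-by-steps (rest s) _))) ⟩
      [ 0 ≡ᵇ n ]· g [] +ℚ ∑ₛ n (λ s → ∑ₚ (rest s) (g ∘ (s ∷_)))
        ∎
      where
      open ≡-Reasoning
      rest : Step → ℕ
      rest s = n ∸ suc (sr s)
      tail-sum : ∀ s → sr s < n →
        ∑[ M ← upTo n ] ∑ₘ M n (rest s) (g ∘ (s ∷_))
          ≡ ∑[ M ← upTo (suc (rest s)) ] ∑ₘ M (rest s) (rest s) (g ∘ (s ∷_))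
      tail-sum s r<n =
        trans (∑-cong (upTo n) (λ M → ∑ₘ-cutoff M _ (ℕₚ.m∸n≤m n (suc (sr s)))))
              (∑-upTo-tail-zero _ (subst (_≤ n) (ℕₚ.+-∸-assoc 1 r<n) (ℕₚ.m∸n≤m n (sr s)))
                               (λ M rest<M → ∑ₘ-tooMany M _ _ _ rest<M))

    ∑ₚ-cong : ∀ n {f g : Path → ℚ} → (∀ p → f p ≡ g p) → ∑ₚ n f ≡ ∑ₚ n g
    ∑ₚ-cong n f≗g = ∑-cong (candidates n) λ p → cong ([ pathLength p ≡ᵇ n ]·_) (f≗g p)

    ∑ₚ-zero : ∀ n {f : Path → ℚ} → (∀ p → f p ≡ 0ℚ) → ∑ₚ n f ≡ 0ℚ
    ∑ₚ-zero n f≗0 = ∑-zero (candidates n) λ p → []·-zero (pathLength p ≡ᵇ n) (λ _ → f≗0 p)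

    ∑ₚ-+ : ∀ n (f g : Path → ℚ) → ∑ₚ n (λ p → f p +ℚ g p) ≡ ∑ₚ n f +ℚ ∑ₚ n g
    ∑ₚ-+ n f g = trans (∑-cong (candidates n) λ p → []·-+ (pathLength p ≡ᵇ n) (f p) (g p))
                       (∑-+ (candidates n) _ _)

    ∑ₚ-*ˡ : ∀ n c (f : Path → ℚ) → ∑ₚ n (λ p → c *ℚ f p) ≡ c *ℚ ∑ₚ n f
    ∑ₚ-*ˡ n c f = trans (∑-cong (candidates n) λ p → []·-*ˡ (pathLength p ≡ᵇ n) c (f p))
                        (∑-*ˡ (candidates n) c _)

    ∑ₚ-*ʳ : ∀ n c (f : Path → ℚ) → ∑ₚ n (λ p → f p *ℚ c) ≡ ∑ₚ n f *ℚ c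
    ∑ₚ-*ʳ n c f = trans (∑-cong (candidates n) λ p → []·-*ʳ (pathLength p ≡ᵇ n) (f p) c)
                        (∑-*ʳ (candidates n) c _)

    ∑ₚ-∑ : ∀ n (xs : List U) (f : U → Path → ℚ) →
           ∑ₚ n (λ p → ∑[ x ← xs ] f x p) ≡ ∑[ x ← xs ] ∑ₚ n (f x)
    ∑ₚ-∑ n xs f = trans (∑-cong (candidates n) λ p → sym (∑-[]· xs (pathLength p ≡ᵇ n) _))
                        (∑-swap (candidates n) xs _)

  isNil : Path → Bool
  isNil []      = true
  isNil (_ ∷ _) = false

  ∑ₚ-nil : ∀ n x → ∑ₚ n (λ p → [ isNil p ]· x) ≡ [ 0 ≡ᵇ n ]· x
  ∑ₚ-nil n x = trans (∑ₚ-unfold n _) (trans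
    (cong ([ 0 ≡ᵇ n ]· x +ℚ_) (∑ₛ-zero n λ s → ∑ₚ-zero (n ∸ suc (sr s)) λ _ → refl))
    (ℚₚ.+-identityʳ _))

  splits : (Path → Path → ℚ) → Path → ℚ
  splits G []      = G [] []
  splits G (s ∷ p) = G [] (s ∷ p) +ℚ splits (λ p₁ p₂ → G (s ∷ p₁) p₂) p

  splits-cong : ∀ p {G H : Path → Path → ℚ} → (∀ p₁ p₂ → G p₁ p₂ ≡ H p₁ p₂) →
                splits G p ≡ splits H p
  splits-cong []      G≗H = G≗H [] []
  splits-cong (s ∷ p) G≗H = cong₂ _+ℚ_ (G≗H [] (s ∷ p)) (splits-cong p (λ p₁ p₂ → G≗H (s ∷ p₁) p₂))

  splits-zero : ∀ p {G : Path → Path → ℚ} → (∀ p₁ p₂ → G p₁ p₂ ≡ 0ℚ) → splits G p ≡ 0ℚ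
  splits-zero []      G≗0 = G≗0 [] []
  splits-zero (s ∷ p) G≗0 =
    trans (cong₂ _+ℚ_ (G≗0 [] (s ∷ p)) (splits-zero p (λ p₁ p₂ → G≗0 (s ∷ p₁) p₂)))
          (ℚₚ.+-identityˡ 0ℚ)

  splits-+ : ∀ p (G H : Path → Path → ℚ) →
             splits (λ p₁ p₂ → G p₁ p₂ +ℚ H p₁ p₂) p ≡ splits G p +ℚ splits H p
  splits-+ []      G H = refl
  splits-+ (s ∷ p) G H = begin
    (G [] (s ∷ p) +ℚ H [] (s ∷ p)) +ℚ splits (λ p₁ p₂ → G (s ∷ p₁) p₂ +ℚ H (s ∷ p₁) p₂) p
      ≡⟨ cong ((G [] (s ∷ p) +ℚ H [] (s ∷ p)) +ℚ_) (splits-+ p _ _) ⟩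
    (G [] (s ∷ p) +ℚ H [] (s ∷ p)) +ℚ (splits (λ p₁ → G (s ∷ p₁)) p +ℚ splits (λ p₁ → H (s ∷ p₁)) p)
      ≡⟨ +-interchange (G [] (s ∷ p)) _ _ _ ⟩
    (G [] (s ∷ p) +ℚ splits (λ p₁ → G (s ∷ p₁)) p) +ℚ (H [] (s ∷ p) +ℚ splits (λ p₁ → H (s ∷ p₁)) p)
      ∎
    where open ≡-Reasoning

  splits-additive : ∀ p (f : ℚ → ℚ) (G : Path → Path → ℚ) → (∀ x y → f (x +ℚ y) ≡ f x +ℚ f y) →
                    splits (λ p₁ p₂ → f (G p₁ p₂)) p ≡ f (splits G p)
  splits-additive []      f G f-+ = refl
  splits-additive (s ∷ p) f G f-+ =
    trans (cong (f (G [] (s ∷ p)) +ℚ_) (splits-additive p f (λ p₁ → G (s ∷ p₁)) f-+)) (sym (f-+ _ _))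

  splits-∑ : ∀ p (xs : List U) (G : U → Path → Path → ℚ) →
             splits (λ p₁ p₂ → ∑[ x ← xs ] G x p₁ p₂) p ≡ ∑[ x ← xs ] splits (G x) p
  splits-∑ []      xs G = refl
  splits-∑ (s ∷ p) xs G =
    trans (cong (∑[ x ← xs ] G x [] (s ∷ p) +ℚ_) (splits-∑ p xs (λ x p₁ → G x (s ∷ p₁))))
          (sym (∑-+ xs _ _))

  splits-nil : ∀ p (K : Path → ℚ) → splits (λ p₁ p₂ → [ isNil p₁ ]· K p₂) p ≡ K p
  splits-nil []      K = refl
  splits-nil (s ∷ p) K = trans (cong (K (s ∷ p) +ℚ_) (splits-zero p (λ _ _ → refl))) (ℚₚ.+-identityʳ _)

  ∑ₚ-splits : ∀ n (G : Path → Path → ℚ) →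
    ∑[ a ← upTo (suc n) ] ∑ₚ a (λ p₁ → ∑ₚ (n ∸ a) (G p₁)) ≡ ∑ₚ n (splits G)
  ∑ₚ-splits = <-rec _ induction-step
    where
    Conv : ℕ → Set
    Conv n = ∀ G → ∑[ a ← upTo (suc n) ] ∑ₚ a (λ p₁ → ∑ₚ (n ∸ a) (G p₁)) ≡ ∑ₚ n (splits G)

    induction-step : ∀ n → (∀ {m} → m < n → Conv m) → Conv n
    induction-step n ih G = begin
      ∑[ a ← upTo (suc n) ] ∑ₚ a (λ p₁ → ∑ₚ (n ∸ a) (G p₁))
        ≡⟨ ∑-cong (upTo (suc n)) (λ a → ∑ₚ-unfold a _) ⟩
      ∑[ a ← upTo (suc n) ] ([ 0 ≡ᵇ a ]· ∑ₚ (n ∸ a) (G []) +ℚ ∑ₛ a (φ a))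
        ≡⟨ ∑-+ (upTo (suc n)) _ _ ⟩
      ∑[ a ← upTo (suc n) ] [ 0 ≡ᵇ a ]· ∑ₚ (n ∸ a) (G []) +ℚ ∑[ a ← upTo (suc n) ] ∑ₛ a (φ a)
        ≡⟨ cong₂ _+ℚ_ (∑-upTo-point (suc n) 0 _) (∑ₛ-triangle n φ) ⟩
      ∑ₚ n (G []) +ℚ ∑ₛ n (λ s → ∑[ a ← upTo (n ∸ sr s) ] φ (suc (sr s) + a) s)
        ≡⟨ cong (∑ₚ n (G []) +ℚ_) (∑ₛ-cong n λ s r<n → trans (reindex s r<n) (ih (rest<n r<n) _)) ⟩
      ∑ₚ n (G []) +ℚ ∑ₛ n (λ s → ∑ₚ (rest s) (splits (λ p₁ p₂ → G (s ∷ p₁) p₂)))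
        ≡⟨ cong (_+ℚ ∑ₛ n (λ s → ∑ₚ (rest s) (splits (λ p₁ p₂ → G (s ∷ p₁) p₂))))
                (∑ₚ-unfold n (G [])) ⟩
      ([ 0 ≡ᵇ n ]· G [] [] +ℚ ∑ₛ n (λ s → ∑ₚ (rest s) (G [] ∘ (s ∷_))))
        +ℚ ∑ₛ n (λ s → ∑ₚ (rest s) (splits (λ p₁ p₂ → G (s ∷ p₁) p₂)))
        ≡⟨ ℚₚ.+-assoc ([ 0 ≡ᵇ n ]· G [] []) _ _ ⟩
      [ 0 ≡ᵇ n ]· G [] [] +ℚ (∑ₛ n (λ s → ∑ₚ (rest s) (G [] ∘ (s ∷_)))
        +ℚ ∑ₛ n (λ s → ∑ₚ (rest s) (splits (λ p₁ p₂ → G (s ∷ p₁) p₂))))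
        ≡⟨ cong ([ 0 ≡ᵇ n ]· G [] [] +ℚ_)
                (sym (trans (∑ₛ-cong n (λ s _ → ∑ₚ-+ (rest s) _ _)) (∑ₛ-+ n _ _))) ⟩
      [ 0 ≡ᵇ n ]· G [] [] +ℚ ∑ₛ n (λ s → ∑ₚ (rest s) (λ q → splits G (s ∷ q)))
        ≡⟨ sym (∑ₚ-unfold n (splits G)) ⟩
      ∑ₚ n (splits G)
        ∎
      where
      open ≡-Reasoning
      rest : Step → ℕ
      rest s = n ∸ suc (sr s)

      φ : ℕ → Step → ℚ
      φ a s = ∑ₚ (a ∸ suc (sr s)) (λ q → ∑ₚ (n ∸ a) (G (s ∷ q)))

      rest<n : ∀ {r} → r < n → n ∸ suc r < n
      rest<n r<n = ℕₚ.∸-monoʳ-< (s≤s z≤n) r<n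

      reindex : ∀ s → sr s < n →
        ∑[ a ← upTo (n ∸ sr s) ] φ (suc (sr s) + a) s
          ≡ ∑[ a ← upTo (suc (rest s)) ] ∑ₚ a (λ q → ∑ₚ (rest s ∸ a) (G (s ∷ q)))
      reindex s r<n = trans
        (cong (λ m → ∑[ a ← upTo m ] φ (suc (sr s) + a) s) (ℕₚ.+-∸-assoc 1 r<n))
        (∑-cong (upTo (suc (rest s))) λ a →
          cong₂ (λ x y → ∑ₚ x (λ q → ∑ₚ y (G (s ∷ q))))
                (ℕₚ.m+n∸m≡n (suc (sr s)) a) (sym (ℕₚ.∸-+-assoc n (suc (sr s)) a)))

  -- Series as sums over paths

  infix 4 _≐_
  _≐_ : Series → (Path → ℚ) → Set
  X ≐ f = ∀ n → X n ≡ ∑ₚ n f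

  ≐-unique : ∀ {X Y f g} → X ≐ f → Y ≐ g → (∀ p → f p ≡ g p) → X ≈ₛ Y
  ≐-unique X≐f Y≐g f≗g n = trans (X≐f n) (trans (∑ₚ-cong n f≗g) (sym (Y≐g n)))

  ≐-⊕ : ∀ {X Y f g} → X ≐ f → Y ≐ g → X ⊕ Y ≐ λ p → f p +ℚ g p
  ≐-⊕ {f = f} {g} X≐f Y≐g n = trans (cong₂ _+ℚ_ (X≐f n) (Y≐g n)) (sym (∑ₚ-+ n f g))

  ≐-ΣS : ∀ (xs : List ℕ) {X : ℕ → Series} {f : ℕ → Path → ℚ} →
         (∀ x → X x ≐ f x) → ΣS xs X ≐ λ p → ∑[ x ← xs ] f x p
  ≐-ΣS xs {f = f} X≐f n = trans (∑-definition xs _) (trans (∑-cong xs λ x → X≐f x n) (sym (∑ₚ-∑ n xs f)))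

  ≐-⊛ : ∀ {X Y f g} → X ≐ f → Y ≐ g → X ⊛ Y ≐ splits (λ p₁ p₂ → f p₁ *ℚ g p₂)
  ≐-⊛ {X} {Y} {f} {g} X≐f Y≐g n = begin
    (X ⊛ Y) n                                                   ≡⟨ ∑-definition (upTo (suc n)) _ ⟩
    ∑[ a ← upTo (suc n) ] X a *ℚ Y (n ∸ a)                       ≡⟨ ∑-cong (upTo (suc n)) product ⟩
    ∑[ a ← upTo (suc n) ] ∑ₚ a (λ p₁ → ∑ₚ (n ∸ a) (λ p₂ → f p₁ *ℚ g p₂)) ≡⟨ ∑ₚ-splits n _ ⟩
    ∑ₚ n (splits (λ p₁ p₂ → f p₁ *ℚ g p₂))                     ∎
    where
    open ≡-Reasoning
    product : ∀ a → X a *ℚ Y (n ∸ a) ≡ ∑ₚ a (λ p₁ → ∑ₚ (n ∸ a) (λ p₂ → f p₁ *ℚ g p₂))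
    product a = begin
      X a *ℚ Y (n ∸ a)                                    ≡⟨ cong₂ _*ℚ_ (X≐f a) (Y≐g (n ∸ a)) ⟩
      ∑ₚ a f *ℚ ∑ₚ (n ∸ a) g                             ≡⟨ sym (∑ₚ-*ʳ a _ f) ⟩
      ∑ₚ a (λ p₁ → f p₁ *ℚ ∑ₚ (n ∸ a) g)                 ≡⟨ ∑ₚ-cong a (λ p₁ → sym (∑ₚ-*ˡ (n ∸ a) (f p₁) g)) ⟩
      ∑ₚ a (λ p₁ → ∑ₚ (n ∸ a) (λ p₂ → f p₁ *ℚ g p₂))     ∎

  oneₛ-≐ : oneₛ ≐ λ p → [ isNil p ]· 1ℚ
  oneₛ-≐ zero    = sym (∑ₚ-nil 0 1ℚ)
  oneₛ-≐ (suc n) = sym (∑ₚ-nil (suc n) 1ℚ)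

  opaque
    unfolding ∑ₚ ∑

    pathSum-≐ : ∀ a b P →
      pathSum a b P ≐ λ p → [ allowedFrom a p ∧ (endH a p ≡ᵇ b) ∧ P (heights a p) ]· weight p
    pathSum-≐ a b P n = ∑-cong (candidates n) λ p →
      guard-length (allowedFrom a p) (endH a p ≡ᵇ b) (pathLength p ≡ᵇ n) (P (heights a p)) (weight p)
      where
      guard-length : ∀ α ε ν π w → (if α ∧ ε ∧ ν ∧ π then w else 0ℚ) ≡ [ ν ]· [ α ∧ ε ∧ π ]· w
      guard-length false ε     ν π w = sym ([]·-0 ν)
      guard-length true  false ν π w = sym ([]·-0 ν)
      guard-length true  true  true  π w = refl
      guard-length true  true  false π w = refl

  Fᵖ : ℕ → ℕ → ℕ → Path → ℚ
  Fᵖ k a b p = [ allowedFrom a p ∧ (endH a p ≡ᵇ b) ∧ allB (λ h → k ≤ᵇ h) (heights a p) ]· weight p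

  primeAbove : ℕ → List ℕ → Bool
  primeAbove c hs = atLeastOneStep hs ∧ allB (λ h → c <ᵇ h) (intermediate hs)

  Aᵖ : ℕ → ℕ → ℕ → Path → ℚ
  Aᵖ h c t p = [ allowedFrom h p ∧ (endH h p ≡ᵇ t) ∧ primeAbove c (heights h p) ]· weight p

  F-≐ : ∀ k a b → F k a b ≐ Fᵖ k a b
  F-≐ k a b = pathSum-≐ a b (allB (λ h → k ≤ᵇ h))

  A-≐ : ∀ k i → A k i ≐ Aᵖ k (k + i) (k + i)
  A-≐ k i = pathSum-≐ k (k + i) (primeAbove (k + i))

  Abar-≐ : ∀ k i → Abar k i ≐ Aᵖ k k (k ∸ i)
  Abar-≐ k i = pathSum-≐ k (k ∸ i) (primeAbove k)

  coefS : Step → ℚ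
  coefS s = coef (sℓ s) (sj s) (sr s)

  prepend : ℕ → Step → ℚ → ℚ
  prepend h s x = [ inS h s ]· (coefS s *ℚ x)

  prepend-0 : ∀ h s → prepend h s 0ℚ ≡ 0ℚ
  prepend-0 h s = trans (cong ([ inS h s ]·_) (ℚₚ.*-zeroʳ (coefS s))) ([]·-0 (inS h s))

  prepend-+ : ∀ h s x y → prepend h s (x +ℚ y) ≡ prepend h s x +ℚ prepend h s y
  prepend-+ h s x y = trans (cong ([ inS h s ]·_) (ℚₚ.*-distribˡ-+ (coefS s) x y)) ([]·-+ (inS h s) _ _)

  prepend-∑ : ∀ h s (xs : List U) f → prepend h s (∑ xs f) ≡ ∑[ x ← xs ] prepend h s (f x)
  prepend-∑ h s xs f = sym (trans (∑-[]· xs (inS h s) _) (cong ([ inS h s ]·_) (∑-*ˡ xs (coefS s) f)))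

  prepend-*ʳ : ∀ h s x y → prepend h s x *ℚ y ≡ prepend h s (x *ℚ y)
  prepend-*ʳ h s x y = trans (sym ([]·-*ʳ (inS h s) _ y)) (cong ([ inS h s ]·_) (ℚₚ.*-assoc (coefS s) x y))

  prepend-[]· : ∀ h s b x → prepend h s ([ b ]· x) ≡ [ b ]· prepend h s x
  prepend-[]· h s b x = trans (cong ([ inS h s ]·_) (sym ([]·-*ˡ b (coefS s) x))) ([]·-comm (inS h s) b _)

  single : (Step → ℚ) → Path → ℚ
  single v []          = 0ℚ
  single v (s ∷ [])    = v s
  single v (_ ∷ _ ∷ _) = 0ℚ

  single-∷ : ∀ v s q → single v (s ∷ q) ≡ [ isNil q ]· v s
  single-∷ v s []      = refl
  single-∷ v s (_ ∷ _) = refl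

  stepWeight : ℕ → (ℕ → ℕ → Bool) → Step → ℚ
  stepWeight m cnd s = [ (toℕ (sj s) ≤ᵇ m) ∧ cnd (toℕ (sℓ s)) (toℕ (sj s)) ]· coefS s

  SQ-≐ : ∀ m cnd → SQ m cnd ≐ single (stepWeight m cnd)
  SQ-≐ m cnd n = begin
    SQ m cnd n
      ≡⟨ Σℚ-concatMap-map (allFin (suc L)) (allFin (suc J)) _ ⟩
    ∑[ ℓ ← allFin (suc L) ] ∑[ j ← allFin (suc J) ] [ guard ℓ j ]· xQ ℓ j n
      ≡⟨ ∑-cong (allFin (suc L)) (λ ℓ → ∑-cong (allFin (suc J)) λ j → sym (length-n-step n ℓ j)) ⟩
    ∑[ ℓ ← allFin (suc L) ] ∑[ j ← allFin (suc J) ] ∑[ r ← upTo n ]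
      [ 0 ≡ᵇ n ∸ suc r ]· stepWeight m cnd (step ℓ j r)
      ≡⟨ sym (∑ₛ-definition n _) ⟩
    ∑ₛ n (λ s → [ 0 ≡ᵇ n ∸ suc (sr s) ]· stepWeight m cnd s)
      ≡⟨ ∑ₛ-cong n (λ s _ → sym (trans (∑ₚ-cong _ (single-∷ _ s)) (∑ₚ-nil _ _))) ⟩
    ∑ₛ n (λ s → ∑ₚ (n ∸ suc (sr s)) (single (stepWeight m cnd) ∘ (s ∷_)))
      ≡⟨ sym (trans (∑ₚ-unfold n _) (trans
           (cong (_+ℚ ∑ₛ n (λ s → ∑ₚ (n ∸ suc (sr s)) (single (stepWeight m cnd) ∘ (s ∷_)))) ([]·-0 (0 ≡ᵇ n)))
           (ℚₚ.+-identityˡ _))) ⟩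
    ∑ₚ n (single (stepWeight m cnd))
      ∎
    where
    open ≡-Reasoning
    guard : Fin (suc L) → Fin (suc J) → Bool
    guard ℓ j = (toℕ j ≤ᵇ m) ∧ cnd (toℕ ℓ) (toℕ j)
    length-n-step : ∀ n ℓ j →
      ∑[ r ← upTo n ] [ 0 ≡ᵇ n ∸ suc r ]· stepWeight m cnd (step ℓ j r) ≡ [ guard ℓ j ]· xQ ℓ j n
    length-n-step zero    ℓ j = trans (∑-[] _) (sym ([]·-0 (guard ℓ j)))
    length-n-step (suc n) ℓ j = ∑-upTo-last n (λ r → stepWeight m cnd (step ℓ j r))

  -- Decomposition at the first return to a lower level

  Fᵖ-[] : ∀ {k h} b → k ≤ h → Fᵖ k h b [] ≡ [ h ≡ᵇ b ]· 1ℚ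
  Fᵖ-[] {k} {h} b k≤h rewrite T⇒≡true (ℕₚ.≤⇒≤ᵇ k≤h) with h ≡ᵇ b
  ... | true  = refl
  ... | false = refl

  Fᵖ-∷ : ∀ {k h} b s q → k ≤ h → Fᵖ k h b (s ∷ q) ≡ prepend h s (Fᵖ k (next h s) b q)
  Fᵖ-∷ {k} {h} b s q k≤h rewrite T⇒≡true (ℕₚ.≤⇒≤ᵇ k≤h) with inS h s
  ... | true  = []·-*ˡ (allowedFrom (next h s) q ∧ (endH (next h s) q ≡ᵇ b)
                         ∧ allB (λ h → k ≤ᵇ h) (heights (next h s) q))
                       (coefS s) (weight q)
  ... | false = refl

  allB-head : ∀ (P : ℕ → Bool) h q → T (allB P (heights h q)) → T (P h)
  allB-head P h []      = proj₁ ∘ T-∧⁻ (P h)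
  allB-head P h (s ∷ q) = proj₁ ∘ T-∧⁻ (P h)

  allB-last : ∀ (P : ℕ → Bool) h q → T (allB P (heights h q)) → T (P (endH h q))
  allB-last P h []      = proj₁ ∘ T-∧⁻ (P h)
  allB-last P h (s ∷ q) = allB-last P (next h s) q ∘ proj₂ ∘ T-∧⁻ (P h)

  Fᵖ-below : ∀ {k h} b q → h < k → Fᵖ k h b q ≡ 0ℚ
  Fᵖ-below {k} {h} b q h<k = []·-false (weight q) λ valid →
    let (_ , _ , above) = T-∧⁻³ (allowedFrom h q) (endH h q ≡ᵇ b) valid in
    ℕₚ.<⇒≱ h<k (ℕₚ.≤ᵇ⇒≤ k h (allB-head (k ≤ᵇ_) h q above))

  Fᵖ-end : ∀ k h b q → Fᵖ k h b q ≡ [ k <ᵇ suc b ]· Fᵖ k h b q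
  Fᵖ-end k h b q = sym ([]·-absorb (k <ᵇ suc b) _ (weight q) λ valid →
    let (_ , ends , above) = T-∧⁻³ (allowedFrom h q) (endH h q ≡ᵇ b) valid in
    ℕₚ.<⇒<ᵇ (s≤s (subst (k ≤_) (ℕₚ.≡ᵇ⇒≡ (endH h q) b ends)
                        (ℕₚ.≤ᵇ⇒≤ k _ (allB-last (k ≤ᵇ_) h q above)))))

  at : ℕ → (Path → ℚ) → ℕ → Path → ℚ
  at m g m′ q = [ m′ ≡ᵇ m ]· g q

  -- passage h c Φ p cuts the walk p from h at the first time (0 included) its height m is ≤ c,
  -- and weighs it as (weight of the part before) · Φ m (rest); passage⁺ starts looking at time 1.
  mutual
    passage : ℕ → ℕ → (ℕ → Path → ℚ) → Path → ℚ
    passage h c Φ p = if h ≤ᵇ c then Φ h p else passage⁺ h c Φ p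

    passage⁺ : ℕ → ℕ → (ℕ → Path → ℚ) → Path → ℚ
    passage⁺ h c Φ []      = 0ℚ
    passage⁺ h c Φ (s ∷ q) = prepend h s (passage (next h s) c Φ q)

  passage-≤ : ∀ {h c} Φ p → h ≤ c → passage h c Φ p ≡ Φ h p
  passage-≤ Φ p h≤c rewrite T⇒≡true (ℕₚ.≤⇒≤ᵇ h≤c) = refl

  passage-> : ∀ {h c} Φ p → c < h → passage h c Φ p ≡ passage⁺ h c Φ p
  passage-> {h} {c} Φ p c<h rewrite ¬T⇒≡false (ℕₚ.<⇒≱ c<h ∘ ℕₚ.≤ᵇ⇒≤ h c) = refl

  mutual
    passage-zero : ∀ p h c {Φ} → (∀ m q → m ≤ c → Φ m q ≡ 0ℚ) → passage h c Φ p ≡ 0ℚ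
    passage-zero p h c Φ≗0 with h ≤ᵇ c in h≤c
    ... | true  = Φ≗0 h p (ℕₚ.≤ᵇ⇒≤ h c (subst T (sym h≤c) tt))
    ... | false = passage⁺-zero p h c Φ≗0

    passage⁺-zero : ∀ p h c {Φ} → (∀ m q → m ≤ c → Φ m q ≡ 0ℚ) → passage⁺ h c Φ p ≡ 0ℚ
    passage⁺-zero []      h c Φ≗0 = refl
    passage⁺-zero (s ∷ q) h c Φ≗0 = trans (cong (prepend h s) (passage-zero q (next h s) c Φ≗0)) (prepend-0 h s)

  ∑-passage-split : ∀ {h c} b q → c < h →
    ∑[ m ← upTo (suc b) ] [ c <ᵇ m ]· passage h m (at m (Fᵖ m m b)) q
      ≡ Fᵖ h h b q +ℚ ∑[ m ← upTo (suc b) ] [ (c <ᵇ m) ∧ not (h ≤ᵇ m) ]· passage⁺ h m (at m (Fᵖ m m b)) q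
  ∑-passage-split {h} {c} b q c<h = begin
    ∑[ m ← upTo (suc b) ] [ c <ᵇ m ]· passage h m (Ψ m) q
      ≡⟨ ∑-guard-split (upTo (suc b)) (h ≤ᵇ_) (c <ᵇ_) _ (λ m h≤m →
           ℕₚ.<⇒<ᵇ (ℕₚ.<-≤-trans c<h (ℕₚ.≤ᵇ⇒≤ h m h≤m))) ⟩
    ∑[ m ← upTo (suc b) ] [ h ≤ᵇ m ]· passage h m (Ψ m) q
      +ℚ ∑[ m ← upTo (suc b) ] [ (c <ᵇ m) ∧ not (h ≤ᵇ m) ]· passage h m (Ψ m) q
      ≡⟨ cong₂ _+ℚ_ (∑-cong (upTo (suc b)) starts-at) (∑-cong (upTo (suc b)) λ m →
           []·-cong ((c <ᵇ m) ∧ not (h ≤ᵇ m)) λ t → passage-> (Ψ m) q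
             (ℕₚ.≰⇒> λ h≤m → subst T (Equivalence.to Boolₚ.T-not-≡ (proj₂ (T-∧⁻ (c <ᵇ m) t)))
                                         (ℕₚ.≤⇒≤ᵇ h≤m))) ⟩
    ∑[ m ← upTo (suc b) ] [ h ≡ᵇ m ]· Fᵖ m m b q
      +ℚ ∑[ m ← upTo (suc b) ] [ (c <ᵇ m) ∧ not (h ≤ᵇ m) ]· passage⁺ h m (Ψ m) q
      ≡⟨ cong (_+ℚ ∑[ m ← upTo (suc b) ] [ (c <ᵇ m) ∧ not (h ≤ᵇ m) ]· passage⁺ h m (Ψ m) q)
              (trans (∑-upTo-point (suc b) h (λ m → Fᵖ m m b q)) (sym (Fᵖ-end h h b q))) ⟩
    Fᵖ h h b q +ℚ ∑[ m ← upTo (suc b) ] [ (c <ᵇ m) ∧ not (h ≤ᵇ m) ]· passage⁺ h m (Ψ m) q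
      ∎
    where
    open ≡-Reasoning
    Ψ : ℕ → ℕ → Path → ℚ
    Ψ m = at m (Fᵖ m m b)
    starts-at : ∀ m → [ h ≤ᵇ m ]· passage h m (Ψ m) q ≡ [ h ≡ᵇ m ]· Fᵖ m m b q
    starts-at m with h ≤ᵇ m in h≤m
    ... | true  = refl
    ... | false = sym ([]·-false _ λ h≡m →
                        subst T h≤m (ℕₚ.≤⇒≤ᵇ (ℕₚ.≤-reflexive (ℕₚ.≡ᵇ⇒≡ h m h≡m))))

  -- A walk either reaches a level ≤ c, or stays above c and is cut at the first visit of its
  -- lowest level m.
  mutual
    Fᵖ-lowest-level : ∀ q {k h c} b → k ≤ suc c →
      Fᵖ k h b q ≡ passage h c (λ m → Fᵖ k m b) q
                   +ℚ ∑[ m ← upTo (suc b) ] [ c <ᵇ m ]· passage h m (at m (Fᵖ m m b)) q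
    Fᵖ-lowest-level q {k} {h} {c} b k≤1+c with ℕₚ.≤-<-connex h c
    ... | inj₂ c<h = Fᵖ-lowest-level-above q b k≤1+c c<h
    ... | inj₁ h≤c = sym (trans
      (cong₂ _+ℚ_ (passage-≤ (λ m → Fᵖ k m b) q h≤c) (∑-zero (upTo (suc b)) never-above))
      (ℚₚ.+-identityʳ _))
      where
      never-above : ∀ m → [ c <ᵇ m ]· passage h m (at m (Fᵖ m m b)) q ≡ 0ℚ
      never-above m = []·-zero (c <ᵇ m) λ c<m →
        let h<m = ℕₚ.≤-<-trans h≤c (ℕₚ.<ᵇ⇒< c m c<m) in
        trans (passage-≤ _ q (ℕₚ.<⇒≤ h<m))
              ([]·-false _ λ h≡m → ℕₚ.<⇒≢ h<m (ℕₚ.≡ᵇ⇒≡ h m h≡m))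

    Fᵖ-lowest-level-above : ∀ q {k h c} b → k ≤ suc c → c < h →
      Fᵖ k h b q ≡ passage h c (λ m → Fᵖ k m b) q
                   +ℚ ∑[ m ← upTo (suc b) ] [ c <ᵇ m ]· passage h m (at m (Fᵖ m m b)) q
    Fᵖ-lowest-level-above [] {k} {h} {c} b k≤1+c c<h = begin
      Fᵖ k h b []
        ≡⟨ trans (Fᵖ-[] b (ℕₚ.≤-trans k≤1+c c<h)) (sym (Fᵖ-[] {h} b ℕₚ.≤-refl)) ⟩
      Fᵖ h h b []
        ≡⟨ sym (trans (ℚₚ.+-identityˡ _) (trans (cong (Fᵖ h h b [] +ℚ_) (∑-zero (upTo (suc b)) λ m → []·-0 _))
                                                (ℚₚ.+-identityʳ _))) ⟩
      0ℚ +ℚ (Fᵖ h h b [] +ℚ ∑[ m ← upTo (suc b) ] [ (c <ᵇ m) ∧ not (h ≤ᵇ m) ]· passage⁺ h m (Ψ m) [])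
        ≡⟨ cong₂ _+ℚ_ (sym (passage-> (λ m → Fᵖ k m b) [] c<h)) (sym (∑-passage-split b [] c<h)) ⟩
      passage h c (λ m → Fᵖ k m b) [] +ℚ ∑[ m ← upTo (suc b) ] [ c <ᵇ m ]· passage h m (Ψ m) []
        ∎
      where
      open ≡-Reasoning
      Ψ : ℕ → ℕ → Path → ℚ
      Ψ m = at m (Fᵖ m m b)
    Fᵖ-lowest-level-above (s ∷ q) {k} {suc h₀} {c} b k≤1+c c<h@(s≤s c≤h₀) = begin
      Fᵖ k h b (s ∷ q)
        ≡⟨ Fᵖ-∷ b s q (ℕₚ.≤-trans k≤1+c c<h) ⟩
      prepend h s (Fᵖ k h′ b q)
        ≡⟨ cong (prepend h s) (Fᵖ-lowest-level q b k≤1+c) ⟩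
      prepend h s (passage h′ c Φ q +ℚ ∑[ m ← upTo (suc b) ] [ c <ᵇ m ]· P m)
        ≡⟨ prepend-+ h s _ _ ⟩
      prepend h s (passage h′ c Φ q) +ℚ prepend h s (∑[ m ← upTo (suc b) ] [ c <ᵇ m ]· P m)
        ≡⟨ cong (prepend h s (passage h′ c Φ q) +ℚ_) continue-above ⟩
      passage⁺ h c Φ (s ∷ q)
        +ℚ (Fᵖ h h b (s ∷ q)
            +ℚ ∑[ m ← upTo (suc b) ] [ (c <ᵇ m) ∧ not (h ≤ᵇ m) ]· passage⁺ h m (Ψ m) (s ∷ q))
        ≡⟨ cong₂ _+ℚ_ (sym (passage-> Φ (s ∷ q) c<h)) (sym (∑-passage-split b (s ∷ q) c<h)) ⟩
      passage h c Φ (s ∷ q) +ℚ ∑[ m ← upTo (suc b) ] [ c <ᵇ m ]· passage h m (Ψ m) (s ∷ q)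
        ∎
      where
      open ≡-Reasoning
      h h′ : ℕ
      h  = suc h₀
      h′ = next h s
      Φ : ℕ → Path → ℚ
      Φ m = Fᵖ k m b
      Ψ : ℕ → ℕ → Path → ℚ
      Ψ m = at m (Fᵖ m m b)
      P : ℕ → ℚ
      P m = passage h′ m (Ψ m) q

      never-below-h : Fᵖ h h′ b q ≡ ∑[ m ← upTo (suc b) ] [ h ≤ᵇ m ]· P m
      never-below-h = trans (Fᵖ-lowest-level q b ℕₚ.≤-refl) (trans
        (cong (_+ℚ ∑[ m ← upTo (suc b) ] [ h ≤ᵇ m ]· P m)
              (passage-zero q h′ h₀ λ m q′ m≤h₀ → Fᵖ-below b q′ (s≤s m≤h₀)))
        (ℚₚ.+-identityˡ _))

      continue-above : prepend h s (∑[ m ← upTo (suc b) ] [ c <ᵇ m ]· P m)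
        ≡ Fᵖ h h b (s ∷ q) +ℚ ∑[ m ← upTo (suc b) ] [ (c <ᵇ m) ∧ not (h ≤ᵇ m) ]· prepend h s (P m)
      continue-above = begin
        prepend h s (∑[ m ← upTo (suc b) ] [ c <ᵇ m ]· P m)
          ≡⟨ cong (prepend h s) (∑-guard-split (upTo (suc b)) (h ≤ᵇ_) (c <ᵇ_) P (λ m h≤m →
               ℕₚ.<⇒<ᵇ (ℕₚ.<-≤-trans c<h (ℕₚ.≤ᵇ⇒≤ h m h≤m)))) ⟩
        prepend h s (∑[ m ← upTo (suc b) ] [ h ≤ᵇ m ]· P m
                     +ℚ ∑[ m ← upTo (suc b) ] [ (c <ᵇ m) ∧ not (h ≤ᵇ m) ]· P m)
          ≡⟨ prepend-+ h s _ _ ⟩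
        prepend h s (∑[ m ← upTo (suc b) ] [ h ≤ᵇ m ]· P m)
          +ℚ prepend h s (∑[ m ← upTo (suc b) ] [ (c <ᵇ m) ∧ not (h ≤ᵇ m) ]· P m)
          ≡⟨ cong₂ _+ℚ_ (cong (prepend h s) (sym never-below-h))
                        (trans (prepend-∑ h s (upTo (suc b)) _) (∑-cong (upTo (suc b)) λ m →
                          prepend-[]· h s ((c <ᵇ m) ∧ not (h ≤ᵇ m)) (P m))) ⟩
        prepend h s (Fᵖ h h′ b q) +ℚ ∑[ m ← upTo (suc b) ] [ (c <ᵇ m) ∧ not (h ≤ᵇ m) ]· prepend h s (P m)
          ≡⟨ cong (_+ℚ ∑[ m ← upTo (suc b) ] [ (c <ᵇ m) ∧ not (h ≤ᵇ m) ]· prepend h s (P m))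
                  (sym (Fᵖ-∷ b s q ℕₚ.≤-refl)) ⟩
        Fᵖ h h b (s ∷ q) +ℚ ∑[ m ← upTo (suc b) ] [ (c <ᵇ m) ∧ not (h ≤ᵇ m) ]· prepend h s (P m)
          ∎

  Fᵖ-decomposition : ∀ p {k a} b → k ≤ a →
    Fᵖ k a b p ≡ [ isNil p ]· [ a ≡ᵇ b ]· 1ℚ
                 +ℚ passage⁺ a a (λ m → Fᵖ k m b) p
                 +ℚ ∑[ m ← upTo (suc b) ] [ a <ᵇ m ]· passage⁺ a m (at m (Fᵖ m m b)) p
  Fᵖ-decomposition [] {k} {a} b k≤a = begin
    Fᵖ k a b []
      ≡⟨ Fᵖ-[] b k≤a ⟩
    [ a ≡ᵇ b ]· 1ℚ
      ≡⟨ sym (trans (cong₂ _+ℚ_ (ℚₚ.+-identityʳ ([ a ≡ᵇ b ]· 1ℚ))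
                                (∑-zero (upTo (suc b)) λ m → []·-0 (a <ᵇ m)))
                    (ℚₚ.+-identityʳ _)) ⟩
    [ a ≡ᵇ b ]· 1ℚ +ℚ 0ℚ +ℚ ∑[ m ← upTo (suc b) ] [ a <ᵇ m ]· 0ℚ
      ∎
    where open ≡-Reasoning
  Fᵖ-decomposition (s ∷ q) {k} {a} b k≤a = begin
    Fᵖ k a b (s ∷ q)
      ≡⟨ Fᵖ-∷ b s q k≤a ⟩
    prepend a s (Fᵖ k a′ b q)
      ≡⟨ cong (prepend a s) (Fᵖ-lowest-level q b (ℕₚ.≤-trans k≤a (ℕₚ.n≤1+n a))) ⟩
    prepend a s (passage a′ a Φ q +ℚ ∑[ m ← upTo (suc b) ] [ a <ᵇ m ]· passage a′ m (Ψ m) q)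
      ≡⟨ prepend-+ a s (passage a′ a Φ q) _ ⟩
    prepend a s (passage a′ a Φ q) +ℚ prepend a s (∑[ m ← upTo (suc b) ] [ a <ᵇ m ]· passage a′ m (Ψ m) q)
      ≡⟨ cong₂ _+ℚ_ (sym (ℚₚ.+-identityˡ (prepend a s (passage a′ a Φ q))))
                    (trans (prepend-∑ a s (upTo (suc b)) _)
           (∑-cong (upTo (suc b)) λ m → prepend-[]· a s (a <ᵇ m) (passage a′ m (Ψ m) q))) ⟩
    0ℚ +ℚ passage⁺ a a Φ (s ∷ q) +ℚ ∑[ m ← upTo (suc b) ] [ a <ᵇ m ]· passage⁺ a m (Ψ m) (s ∷ q)
      ∎
    where
    open ≡-Reasoning
    a′ : ℕ
    a′ = next a s
    Φ : ℕ → Path → ℚ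
    Φ m = Fᵖ k m b
    Ψ : ℕ → ℕ → Path → ℚ
    Ψ m = at m (Fᵖ m m b)

  Aᵖ-[] : ∀ h c t → Aᵖ h c t [] ≡ 0ℚ
  Aᵖ-[] h c t with h ≡ᵇ t
  ... | true  = refl
  ... | false = refl

  primeAbove-∷ : ∀ h c s s′ q →
    primeAbove c (heights h (s ∷ s′ ∷ q)) ≡ (c <ᵇ next h s) ∧ primeAbove c (heights (next h s) (s′ ∷ q))
  primeAbove-∷ h c s s′ []      = refl
  primeAbove-∷ h c s s′ (_ ∷ _) = refl

  Aᵖ-∷ : ∀ h c t s q →
    Aᵖ h c t (s ∷ q)
      ≡ prepend h s ([ isNil q ]· [ next h s ≡ᵇ t ]· 1ℚ +ℚ [ c <ᵇ next h s ]· Aᵖ (next h s) c t q)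
  Aᵖ-∷ h c t s [] =
    trans (one-step (inS h s) (next h s ≡ᵇ t) (c <ᵇ next h s) (coefS s))
          (cong (λ z → prepend h s ([ next h s ≡ᵇ t ]· 1ℚ +ℚ [ c <ᵇ next h s ]· z)) (sym (Aᵖ-[] (next h s) c t)))
    where
    one-step : ∀ ι ε γ w → [ (ι ∧ true) ∧ ε ∧ true ]· (w *ℚ 1ℚ) ≡ [ ι ]· (w *ℚ ([ ε ]· 1ℚ +ℚ [ γ ]· 0ℚ))
    one-step false ε     γ w = refl
    one-step true  true  γ w = cong (w *ℚ_) (sym (trans (cong (1ℚ +ℚ_) ([]·-0 γ)) (ℚₚ.+-identityʳ 1ℚ)))
    one-step true  false γ w = sym (trans (cong (w *ℚ_) (trans (ℚₚ.+-identityˡ _) ([]·-0 γ))) (ℚₚ.*-zeroʳ w))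
  Aᵖ-∷ h c t s (s′ ∷ q) rewrite primeAbove-∷ h c s s′ q =
    more-steps (inS h s) (allowedFrom h′ (s′ ∷ q)) (endH h′ (s′ ∷ q) ≡ᵇ t) (c <ᵇ h′)
               (primeAbove c (heights h′ (s′ ∷ q))) (coefS s) (weight (s′ ∷ q))
    where
    h′ : ℕ
    h′ = next h s
    more-steps : ∀ ι α ε γ π w v →
      [ (ι ∧ α) ∧ ε ∧ γ ∧ π ]· (w *ℚ v) ≡ [ ι ]· (w *ℚ (0ℚ +ℚ [ γ ]· [ α ∧ ε ∧ π ]· v))
    more-steps false α     ε     γ     π w v = refl
    more-steps true  α     ε     γ     π w v = trans (lemma α ε γ π) (cong (w *ℚ_) (sym (ℚₚ.+-identityˡ _)))
      where
      lemma : ∀ α ε γ π → [ α ∧ ε ∧ γ ∧ π ]· (w *ℚ v) ≡ w *ℚ [ γ ]· [ α ∧ ε ∧ π ]· v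
      lemma true  true  true  π = []·-*ˡ π w v
      lemma true  true  false π = sym (ℚₚ.*-zeroʳ w)
      lemma true  false γ     π = sym (trans (cong (w *ℚ_) ([]·-0 γ)) (ℚₚ.*-zeroʳ w))
      lemma false ε     γ     π = sym (trans (cong (w *ℚ_) ([]·-0 γ)) (ℚₚ.*-zeroʳ w))

  passage-split : ∀ h c Ξ q → passage h c Ξ q ≡ [ h <ᵇ suc c ]· Ξ h q +ℚ [ c <ᵇ h ]· passage⁺ h c Ξ q
  passage-split h c Ξ q with ℕₚ.≤-<-connex h c
  ... | inj₁ h≤c rewrite T⇒≡true (ℕₚ.≤⇒≤ᵇ h≤c) | T⇒≡true (ℕₚ.<⇒<ᵇ (s≤s h≤c))
                       | ¬T⇒≡false (ℕₚ.≤⇒≯ h≤c ∘ ℕₚ.<ᵇ⇒< c h) = sym (ℚₚ.+-identityʳ _)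
  ... | inj₂ c<h rewrite ¬T⇒≡false (ℕₚ.<⇒≱ c<h ∘ ℕₚ.≤ᵇ⇒≤ h c) | T⇒≡true (ℕₚ.<⇒<ᵇ c<h)
                       | ¬T⇒≡false (ℕₚ.<⇒≱ c<h ∘ ℕₚ.≤-pred ∘ ℕₚ.<ᵇ⇒< h (suc c)) = sym (ℚₚ.+-identityˡ _)

  ∑-splits-Aᵖ : ∀ p h c (Ξ : ℕ → Path → ℚ) →
    ∑[ m ← upTo (suc c) ] splits (λ p₁ p₂ → Aᵖ h c m p₁ *ℚ Ξ m p₂) p ≡ passage⁺ h c Ξ p
  ∑-splits-Aᵖ [] h c Ξ = ∑-zero (upTo (suc c)) λ m →
    trans (cong (_*ℚ Ξ m []) (Aᵖ-[] h c m)) (ℚₚ.*-zeroˡ (Ξ m []))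
  ∑-splits-Aᵖ (s ∷ q) h c Ξ = begin
    ∑[ m ← upTo (suc c) ] (Aᵖ h c m [] *ℚ Ξ m (s ∷ q)
                           +ℚ splits (λ p₁ p₂ → Aᵖ h c m (s ∷ p₁) *ℚ Ξ m p₂) q)
      ≡⟨ ∑-cong (upTo (suc c)) (λ m → trans
           (cong₂ _+ℚ_ (trans (cong (_*ℚ Ξ m (s ∷ q)) (Aᵖ-[] h c m)) (ℚₚ.*-zeroˡ (Ξ m (s ∷ q))))
                       (splits-cong q (λ p₁ p₂ → first-step m p₁ p₂)))
           (ℚₚ.+-identityˡ _)) ⟩
    ∑[ m ← upTo (suc c) ] splits (λ p₁ p₂ → prepend h s ([ isNil p₁ ]· [ h′ ≡ᵇ m ]· Ξ m p₂
                                                       +ℚ [ c <ᵇ h′ ]· (Aᵖ h′ c m p₁ *ℚ Ξ m p₂))) q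
      ≡⟨ ∑-cong (upTo (suc c)) (λ m → trans (splits-additive q (prepend h s) _ (prepend-+ h s))
           (cong (prepend h s) (trans (splits-+ q _ _) (cong₂ _+ℚ_ (splits-nil q _)
             (splits-additive q ([ c <ᵇ h′ ]·_) _ ([]·-+ (c <ᵇ h′))))))) ⟩
    ∑[ m ← upTo (suc c) ] prepend h s ([ h′ ≡ᵇ m ]· Ξ m q
                                       +ℚ [ c <ᵇ h′ ]· splits (λ p₁ p₂ → Aᵖ h′ c m p₁ *ℚ Ξ m p₂) q)
      ≡⟨ sym (prepend-∑ h s (upTo (suc c)) _) ⟩
    prepend h s (∑[ m ← upTo (suc c) ] ([ h′ ≡ᵇ m ]· Ξ m q
                                        +ℚ [ c <ᵇ h′ ]· splits (λ p₁ p₂ → Aᵖ h′ c m p₁ *ℚ Ξ m p₂) q))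
      ≡⟨ cong (prepend h s) (trans (∑-+ (upTo (suc c)) _ _) (cong₂ _+ℚ_
           (∑-upTo-point (suc c) h′ (λ m → Ξ m q))
           (trans (∑-[]· (upTo (suc c)) (c <ᵇ h′) _) (cong ([ c <ᵇ h′ ]·_) (∑-splits-Aᵖ q h′ c Ξ))))) ⟩
    prepend h s ([ h′ <ᵇ suc c ]· Ξ h′ q +ℚ [ c <ᵇ h′ ]· passage⁺ h′ c Ξ q)
      ≡⟨ cong (prepend h s) (sym (passage-split h′ c Ξ q)) ⟩
    passage⁺ h c Ξ (s ∷ q)
      ∎
    where
    open ≡-Reasoning
    h′ : ℕ
    h′ = next h s
    first-step : ∀ m p₁ p₂ → Aᵖ h c m (s ∷ p₁) *ℚ Ξ m p₂
      ≡ prepend h s ([ isNil p₁ ]· [ h′ ≡ᵇ m ]· Ξ m p₂ +ℚ [ c <ᵇ h′ ]· (Aᵖ h′ c m p₁ *ℚ Ξ m p₂))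
    first-step m p₁ p₂ = begin
      Aᵖ h c m (s ∷ p₁) *ℚ Ξ m p₂
        ≡⟨ cong (_*ℚ Ξ m p₂) (Aᵖ-∷ h c m s p₁) ⟩
      prepend h s ([ isNil p₁ ]· [ h′ ≡ᵇ m ]· 1ℚ +ℚ [ c <ᵇ h′ ]· Aᵖ h′ c m p₁) *ℚ Ξ m p₂
        ≡⟨ prepend-*ʳ h s ([ isNil p₁ ]· [ h′ ≡ᵇ m ]· 1ℚ +ℚ [ c <ᵇ h′ ]· Aᵖ h′ c m p₁) (Ξ m p₂) ⟩
      prepend h s (([ isNil p₁ ]· [ h′ ≡ᵇ m ]· 1ℚ +ℚ [ c <ᵇ h′ ]· Aᵖ h′ c m p₁) *ℚ Ξ m p₂)
        ≡⟨ cong (prepend h s) (trans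
             (ℚₚ.*-distribʳ-+ (Ξ m p₂) ([ isNil p₁ ]· [ h′ ≡ᵇ m ]· 1ℚ) ([ c <ᵇ h′ ]· Aᵖ h′ c m p₁))
             (cong₂ _+ℚ_ (guards-*-1 (isNil p₁) (h′ ≡ᵇ m) (Ξ m p₂))
                         (sym ([]·-*ʳ (c <ᵇ h′) (Aᵖ h′ c m p₁) (Ξ m p₂))))) ⟩
      prepend h s ([ isNil p₁ ]· [ h′ ≡ᵇ m ]· Ξ m p₂ +ℚ [ c <ᵇ h′ ]· (Aᵖ h′ c m p₁ *ℚ Ξ m p₂))
        ∎
      where
      guards-*-1 : ∀ a b y → ([ a ]· [ b ]· 1ℚ) *ℚ y ≡ [ a ]· [ b ]· y
      guards-*-1 true  true  y = ℚₚ.*-identityˡ y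
      guards-*-1 true  false y = ℚₚ.*-zeroˡ y
      guards-*-1 false b     y = ℚₚ.*-zeroˡ y

  splits-Aᵖ-landing : ∀ p h m (G : Path → ℚ) →
    splits (λ p₁ p₂ → Aᵖ h m m p₁ *ℚ G p₂) p ≡ passage⁺ h m (at m G) p
  splits-Aᵖ-landing p h m G = begin
    splits (λ p₁ p₂ → Aᵖ h m m p₁ *ℚ G p₂) p
      ≡⟨ sym ([]·-true _ (ℕₚ.<⇒<ᵇ (ℕₚ.n<1+n m))) ⟩
    [ m <ᵇ suc m ]· splits (λ p₁ p₂ → Aᵖ h m m p₁ *ℚ G p₂) p
      ≡⟨ sym (∑-upTo-point (suc m) m _) ⟩
    ∑[ m′ ← upTo (suc m) ] [ m ≡ᵇ m′ ]· splits (λ p₁ p₂ → Aᵖ h m m′ p₁ *ℚ G p₂) p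
      ≡⟨ ∑-cong (upTo (suc m)) (λ m′ → trans (sym (splits-additive p ([ m ≡ᵇ m′ ]·_) _ ([]·-+ (m ≡ᵇ m′))))
           (splits-cong p λ p₁ p₂ → trans ([]·-*ˡ (m ≡ᵇ m′) (Aᵖ h m m′ p₁) (G p₂))
                                          (cong (λ b → Aᵖ h m m′ p₁ *ℚ [ b ]· G p₂) (≡ᵇ-sym m m′)))) ⟩
    ∑[ m′ ← upTo (suc m) ] splits (λ p₁ p₂ → Aᵖ h m m′ p₁ *ℚ at m G m′ p₂) p
      ≡⟨ ∑-splits-Aᵖ p h m (at m G) ⟩
    passage⁺ h m (at m G) p
      ∎
    where open ≡-Reasoning

  returningᵖ : ℕ → ℕ → ℕ → Path → ℚ
  returningᵖ k a b p = ∑[ m ← range k a ] splits (λ p₁ p₂ → Aᵖ a a (a ∸ (a ∸ m)) p₁ *ℚ Fᵖ k m b p₂) p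

  risingᵖ : ℕ → ℕ → Path → ℚ
  risingᵖ a b p =
    ∑[ m ← range (suc a) b ] splits (λ p₁ p₂ → Aᵖ a (a + (m ∸ a)) (a + (m ∸ a)) p₁ *ℚ Fᵖ m m b p₂) p

  risingᵖ-below : ∀ {a b} p → b ≤ a → risingᵖ a b p ≡ 0ℚ
  risingᵖ-below {a} {b} p b≤a =
    trans (cong (λ ms → ∑[ m ← ms ] splits (λ p₁ p₂ → Aᵖ a (a + (m ∸ a)) (a + (m ∸ a)) p₁ *ℚ Fᵖ m m b p₂) p)
                (range-empty (s≤s b≤a)))
          (∑-[] _)

  ≐-returning : ∀ k a b → ΣS (range k a) (λ m → Abar a (a ∸ m) ⊛ F k m b) ≐ returningᵖ k a b
  ≐-returning k a b = ≐-ΣS (range k a) λ m → ≐-⊛ (Abar-≐ a (a ∸ m)) (F-≐ k m b)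

  ≐-rising : ∀ a b → ΣS (range (suc a) b) (λ m → A a (m ∸ a) ⊛ F m m b) ≐ risingᵖ a b
  ≐-rising a b = ≐-ΣS (range (suc a) b) λ m → ≐-⊛ (A-≐ a (m ∸ a)) (F-≐ m m b)

  Fᵖ-first-return : ∀ p {k a} b → k ≤ a →
    Fᵖ k a b p ≡ [ isNil p ]· [ a ≡ᵇ b ]· 1ℚ +ℚ returningᵖ k a b p +ℚ risingᵖ a b p
  Fᵖ-first-return p {k} {a} b k≤a = trans (Fᵖ-decomposition p b k≤a)
    (cong₂ (λ x y → [ isNil p ]· [ a ≡ᵇ b ]· 1ℚ +ℚ x +ℚ y) (sym returning) (sym rising))
    where
    open ≡-Reasoning
    returning : returningᵖ k a b p ≡ passage⁺ a a (λ m → Fᵖ k m b) p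
    returning = begin
      ∑[ m ← range k a ] splits (λ p₁ p₂ → Aᵖ a a (a ∸ (a ∸ m)) p₁ *ℚ Fᵖ k m b p₂) p
        ≡⟨ ∑-range-from k a _ (λ m m<k → splits-zero p λ p₁ p₂ →
             trans (cong (Aᵖ a a (a ∸ (a ∸ m)) p₁ *ℚ_) (Fᵖ-below b p₂ m<k))
                   (ℚₚ.*-zeroʳ (Aᵖ a a (a ∸ (a ∸ m)) p₁))) ⟩
      ∑[ m ← upTo (suc a) ] splits (λ p₁ p₂ → Aᵖ a a (a ∸ (a ∸ m)) p₁ *ℚ Fᵖ k m b p₂) p
        ≡⟨ ∑-upTo-cong (suc a) (λ m m≤a → cong (λ t → splits (λ p₁ p₂ → Aᵖ a a t p₁ *ℚ Fᵖ k m b p₂) p)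
             (ℕₚ.m∸[m∸n]≡n (ℕₚ.≤-pred m≤a))) ⟩
      ∑[ m ← upTo (suc a) ] splits (λ p₁ p₂ → Aᵖ a a m p₁ *ℚ Fᵖ k m b p₂) p
        ≡⟨ ∑-splits-Aᵖ p a a (λ m → Fᵖ k m b) ⟩
      passage⁺ a a (λ m → Fᵖ k m b) p
        ∎
    rising : risingᵖ a b p ≡ ∑[ m ← upTo (suc b) ] [ a <ᵇ m ]· passage⁺ a m (at m (Fᵖ m m b)) p
    rising = trans (∑-range (suc a) b _) (∑-cong (upTo (suc b)) λ m →
      []·-cong (a <ᵇ m) λ a<m → trans
        (cong (λ t → splits (λ p₁ p₂ → Aᵖ a t t p₁ *ℚ Fᵖ m m b p₂) p)
              (ℕₚ.m+[n∸m]≡n (ℕₚ.<⇒≤ (ℕₚ.<ᵇ⇒< a m a<m))))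
        (splits-Aᵖ-landing p a m (Fᵖ m m b)))

  F-recurrence-diagonal : ∀ k k₁ → k ≤ k₁ →
    F k k₁ k₁ ≈ₛ oneₛ ⊕ ΣS (range k k₁) (λ m → Abar k₁ (k₁ ∸ m) ⊛ F k m k₁)
  F-recurrence-diagonal k a k≤a = ≐-unique (F-≐ k a a) (≐-⊕ oneₛ-≐ (≐-returning k a a)) λ p → begin
    Fᵖ k a a p
      ≡⟨ Fᵖ-first-return p a k≤a ⟩
    [ isNil p ]· [ a ≡ᵇ a ]· 1ℚ +ℚ returningᵖ k a a p +ℚ risingᵖ a a p
      ≡⟨ cong₂ (λ x y → [ isNil p ]· [ x ]· 1ℚ +ℚ returningᵖ k a a p +ℚ y)
               (T⇒≡true (ℕₚ.≡⇒≡ᵇ a a refl)) (risingᵖ-below p ℕₚ.≤-refl) ⟩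
    [ isNil p ]· 1ℚ +ℚ returningᵖ k a a p +ℚ 0ℚ
      ≡⟨ ℚₚ.+-identityʳ ([ isNil p ]· 1ℚ +ℚ returningᵖ k a a p) ⟩
    [ isNil p ]· 1ℚ +ℚ returningᵖ k a a p
      ∎
    where open ≡-Reasoning

  F-recurrence-up : ∀ k k₁ k₂ → k ≤ k₁ → k₁ < k₂ →
    F k k₁ k₂ ≈ₛ ΣS (range k k₁) (λ m → Abar k₁ (k₁ ∸ m) ⊛ F k m k₂)
                 ⊕ ΣS (range (suc k₁) k₂) (λ m → A k₁ (m ∸ k₁) ⊛ F m m k₂)
  F-recurrence-up k a b k≤a a<b = ≐-unique (F-≐ k a b) (≐-⊕ (≐-returning k a b) (≐-rising a b)) λ p → begin
    Fᵖ k a b p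
      ≡⟨ Fᵖ-first-return p b k≤a ⟩
    [ isNil p ]· [ a ≡ᵇ b ]· 1ℚ +ℚ returningᵖ k a b p +ℚ risingᵖ a b p
      ≡⟨ cong (λ x → [ isNil p ]· [ x ]· 1ℚ +ℚ returningᵖ k a b p +ℚ risingᵖ a b p)
              (¬T⇒≡false (ℕₚ.<⇒≢ a<b ∘ ℕₚ.≡ᵇ⇒≡ a b)) ⟩
    [ isNil p ]· 0ℚ +ℚ returningᵖ k a b p +ℚ risingᵖ a b p
      ≡⟨ cong (λ x → x +ℚ returningᵖ k a b p +ℚ risingᵖ a b p) ([]·-0 (isNil p)) ⟩
    0ℚ +ℚ returningᵖ k a b p +ℚ risingᵖ a b p
      ≡⟨ cong (_+ℚ risingᵖ a b p) (ℚₚ.+-identityˡ (returningᵖ k a b p)) ⟩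
    returningᵖ k a b p +ℚ risingᵖ a b p
      ∎
    where open ≡-Reasoning

  F-recurrence-down : ∀ k k₁ k₂ → k ≤ k₂ → k₂ < k₁ →
    F k k₁ k₂ ≈ₛ ΣS (range k k₁) (λ m → Abar k₁ (k₁ ∸ m) ⊛ F k m k₂)
  F-recurrence-down k a b k≤b b<a = ≐-unique (F-≐ k a b) (≐-returning k a b) λ p → begin
    Fᵖ k a b p
      ≡⟨ Fᵖ-first-return p b (ℕₚ.≤-trans k≤b (ℕₚ.<⇒≤ b<a)) ⟩
    [ isNil p ]· [ a ≡ᵇ b ]· 1ℚ +ℚ returningᵖ k a b p +ℚ risingᵖ a b p
      ≡⟨ cong₂ (λ x y → [ isNil p ]· [ x ]· 1ℚ +ℚ returningᵖ k a b p +ℚ y)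
               (¬T⇒≡false (ℕₚ.<⇒≢ b<a ∘ sym ∘ ℕₚ.≡ᵇ⇒≡ a b)) (risingᵖ-below p (ℕₚ.<⇒≤ b<a)) ⟩
    [ isNil p ]· 0ℚ +ℚ returningᵖ k a b p +ℚ 0ℚ
      ≡⟨ trans (ℚₚ.+-identityʳ _) (trans (cong (_+ℚ returningᵖ k a b p) ([]·-0 (isNil p)))
                                          (ℚₚ.+-identityˡ (returningᵖ k a b p))) ⟩
    returningᵖ k a b p
      ∎
    where open ≡-Reasoning

  -- Decomposition of prime walks at their first and last steps

  splitLast : (Path → Step → ℚ) → Path → ℚ
  splitLast K []           = 0ℚ
  splitLast K (s ∷ [])     = K [] s
  splitLast K (s ∷ s′ ∷ q) = splitLast (λ q′ → K (s ∷ q′)) (s′ ∷ q)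

  splitLast-cong : ∀ p {K K′ : Path → Step → ℚ} → (∀ q s → K q s ≡ K′ q s) →
                   splitLast K p ≡ splitLast K′ p
  splitLast-cong []           K≗K′ = refl
  splitLast-cong (s ∷ [])     K≗K′ = K≗K′ [] s
  splitLast-cong (s ∷ s′ ∷ q) K≗K′ = splitLast-cong (s′ ∷ q) (λ q′ → K≗K′ (s ∷ q′))

  splitLast-linear : ∀ p (f : ℚ → ℚ) (K : Path → Step → ℚ) → f 0ℚ ≡ 0ℚ →
                     splitLast (λ q s → f (K q s)) p ≡ f (splitLast K p)
  splitLast-linear []           f K f0 = sym f0
  splitLast-linear (s ∷ [])     f K f0 = refl
  splitLast-linear (s ∷ s′ ∷ q) f K f0 = splitLast-linear (s′ ∷ q) f (λ q′ → K (s ∷ q′)) f0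

  splitLast-∑ : ∀ p (xs : List U) (K : U → Path → Step → ℚ) →
                splitLast (λ q s → ∑[ x ← xs ] K x q s) p ≡ ∑[ x ← xs ] splitLast (K x) p
  splitLast-∑ []           xs K = sym (∑-zero xs λ _ → refl)
  splitLast-∑ (s ∷ [])     xs K = refl
  splitLast-∑ (s ∷ s′ ∷ q) xs K = splitLast-∑ (s′ ∷ q) xs (λ x q′ → K x (s ∷ q′))

  splitLast-∷ : ∀ s q (K : Path → Step → ℚ) → (∀ s′ → K [] s′ ≡ 0ℚ) →
                splitLast K (s ∷ q) ≡ splitLast (λ q′ → K (s ∷ q′)) q
  splitLast-∷ s []      K K[]≗0 = K[]≗0 s
  splitLast-∷ s (_ ∷ _) K K[]≗0 = refl

  splits-single-left : ∀ v (Y : Path → ℚ) s q →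
                       splits (λ p₁ p₂ → single v p₁ *ℚ Y p₂) (s ∷ q) ≡ v s *ℚ Y q
  splits-single-left v Y s q = begin
    single v [] *ℚ Y (s ∷ q) +ℚ splits (λ p₁ p₂ → single v (s ∷ p₁) *ℚ Y p₂) q
      ≡⟨ cong₂ _+ℚ_ (ℚₚ.*-zeroˡ (Y (s ∷ q))) (splits-cong q λ p₁ p₂ →
           trans (cong (_*ℚ Y p₂) (single-∷ v s p₁)) (sym ([]·-*ʳ (isNil p₁) (v s) (Y p₂)))) ⟩
    0ℚ +ℚ splits (λ p₁ p₂ → [ isNil p₁ ]· (v s *ℚ Y p₂)) q
      ≡⟨ trans (ℚₚ.+-identityˡ _) (splits-nil q (λ p₂ → v s *ℚ Y p₂)) ⟩
    v s *ℚ Y q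
      ∎
    where open ≡-Reasoning

  splits-single-right : ∀ v (H : Path → ℚ) p →
                        splits (λ q r → H q *ℚ single v r) p ≡ splitLast (λ q s → H q *ℚ v s) p
  splits-single-right v H []           = ℚₚ.*-zeroʳ (H [])
  splits-single-right v H (s ∷ [])     = trans (cong (H [] *ℚ v s +ℚ_) (ℚₚ.*-zeroʳ (H (s ∷ []))))
                                               (ℚₚ.+-identityʳ _)
  splits-single-right v H (s ∷ s′ ∷ q) = trans (cong (_+ℚ splits (λ q₁ r → H (s ∷ q₁) *ℚ single v r) (s′ ∷ q))
                                                     (ℚₚ.*-zeroʳ (H [])))
    (trans (ℚₚ.+-identityˡ _) (splits-single-right v (λ q′ → H (s ∷ q′)) (s′ ∷ q)))

  aboveThenStep : ℕ → ℕ → ℕ → Path → Step → ℚ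
  aboveThenStep c t h q s =
    [ allowedFrom h q ∧ allB (c <ᵇ_) (heights h q) ]· weight q
      *ℚ [ inS (endH h q) s ∧ (next (endH h q) s ≡ᵇ t) ]· coefS s

  aboveThenStep-∷ : ∀ c t h s q s′ →
    aboveThenStep c t h (s ∷ q) s′ ≡ [ c <ᵇ h ]· prepend h s (aboveThenStep c t (next h s) q s′)
  aboveThenStep-∷ c t h s q s′ = reassociate (inS h s) (allowedFrom (next h s) q) (c <ᵇ h)
    (allB (c <ᵇ_) (heights (next h s) q)) (coefS s) (weight q)
    ([ inS (endH (next h s) q) s′ ∧ (next (endH (next h s) q) s′ ≡ᵇ t) ]· coefS s′)
    where
    w*0*x≡0 : ∀ w x → w *ℚ (0ℚ *ℚ x) ≡ 0ℚ
    w*0*x≡0 w x = trans (cong (w *ℚ_) (ℚₚ.*-zeroˡ x)) (ℚₚ.*-zeroʳ w)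
    reassociate : ∀ ι α γ β w v x →
      [ (ι ∧ α) ∧ γ ∧ β ]· (w *ℚ v) *ℚ x ≡ [ γ ]· [ ι ]· (w *ℚ ([ α ∧ β ]· v *ℚ x))
    reassociate true  true  true  true  w v x = ℚₚ.*-assoc w v x
    reassociate true  true  true  false w v x = trans (ℚₚ.*-zeroˡ x) (sym (w*0*x≡0 w x))
    reassociate true  false true  β     w v x = trans (ℚₚ.*-zeroˡ x) (sym (w*0*x≡0 w x))
    reassociate true  true  false β     w v x = ℚₚ.*-zeroˡ x
    reassociate true  false false β     w v x = ℚₚ.*-zeroˡ x
    reassociate false α     true  β     w v x = ℚₚ.*-zeroˡ x
    reassociate false α     false β     w v x = ℚₚ.*-zeroˡ x

  Aᵖ-splitLast : ∀ q h c t → [ c <ᵇ h ]· Aᵖ h c t q ≡ splitLast (aboveThenStep c t h) q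
  Aᵖ-splitLast []           h c t = trans (cong ([ c <ᵇ h ]·_) (Aᵖ-[] h c t)) ([]·-0 (c <ᵇ h))
  Aᵖ-splitLast (s ∷ [])     h c t = one-step (c <ᵇ h) (inS h s) (next h s ≡ᵇ t) (coefS s)
    where
    one-step : ∀ γ ι ε w →
      [ γ ]· [ (ι ∧ true) ∧ ε ∧ true ]· (w *ℚ 1ℚ) ≡ [ true ∧ γ ∧ true ]· 1ℚ *ℚ [ ι ∧ ε ]· w
    one-step false ι     ε     w = sym (ℚₚ.*-zeroˡ ([ ι ∧ ε ]· w))
    one-step true  false ε     w = sym (ℚₚ.*-identityˡ 0ℚ)
    one-step true  true  false w = sym (ℚₚ.*-identityˡ 0ℚ)
    one-step true  true  true  w = trans (ℚₚ.*-identityʳ w) (sym (ℚₚ.*-identityˡ w))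
  Aᵖ-splitLast (s ∷ s′ ∷ q) h c t = begin
    [ c <ᵇ h ]· Aᵖ h c t (s ∷ s′ ∷ q)
      ≡⟨ cong ([ c <ᵇ h ]·_) (Aᵖ-∷ h c t s (s′ ∷ q)) ⟩
    [ c <ᵇ h ]· prepend h s (0ℚ +ℚ [ c <ᵇ h′ ]· Aᵖ h′ c t (s′ ∷ q))
      ≡⟨ cong (λ x → [ c <ᵇ h ]· prepend h s x) (trans (ℚₚ.+-identityˡ _) (Aᵖ-splitLast (s′ ∷ q) h′ c t)) ⟩
    [ c <ᵇ h ]· prepend h s (splitLast (aboveThenStep c t h′) (s′ ∷ q))
      ≡⟨ sym (splitLast-linear (s′ ∷ q) (λ x → [ c <ᵇ h ]· prepend h s x) _
                (trans (cong ([ c <ᵇ h ]·_) (prepend-0 h s)) ([]·-0 (c <ᵇ h)))) ⟩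
    splitLast (λ q′ s″ → [ c <ᵇ h ]· prepend h s (aboveThenStep c t h′ q′ s″)) (s′ ∷ q)
      ≡⟨ sym (splitLast-cong (s′ ∷ q) (aboveThenStep-∷ c t h s)) ⟩
    splitLast (aboveThenStep c t h) (s ∷ s′ ∷ q)
      ∎
    where
    open ≡-Reasoning
    h′ : ℕ
    h′ = next h s

  Fᵖ-then-step : ∀ {k c t} (I₂ : List ℕ) (v₂ : ℕ → Step → ℚ) →
    (∀ e s → c < e → ∑[ i₂ ← I₂ ] [ e ≡ᵇ k + i₂ ]· v₂ i₂ s ≡ [ inS e s ∧ (next e s ≡ᵇ t) ]· coefS s) →
    ∀ h q s → ∑[ i₂ ← I₂ ] Fᵖ (suc c) h (k + i₂) q *ℚ v₂ i₂ s ≡ aboveThenStep c t h q s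
  Fᵖ-then-step {k} {c} {t} I₂ v₂ last-step h q s = begin
    ∑[ i₂ ← I₂ ] Fᵖ (suc c) h (k + i₂) q *ℚ v₂ i₂ s
      ≡⟨ ∑-cong I₂ (λ i₂ →
           move-end-guard (allowedFrom h q) (endH h q ≡ᵇ k + i₂) above (weight q) (v₂ i₂ s)) ⟩
    ∑[ i₂ ← I₂ ] [ allowedFrom h q ∧ above ]· weight q *ℚ [ endH h q ≡ᵇ k + i₂ ]· v₂ i₂ s
      ≡⟨ ∑-*ˡ I₂ ([ allowedFrom h q ∧ above ]· weight q) (λ i₂ → [ endH h q ≡ᵇ k + i₂ ]· v₂ i₂ s) ⟩
    [ allowedFrom h q ∧ above ]· weight q *ℚ (∑[ i₂ ← I₂ ] [ endH h q ≡ᵇ k + i₂ ]· v₂ i₂ s)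
      ≡⟨ guarded-*-cong (allowedFrom h q ∧ above) (weight q) (λ valid →
           last-step (endH h q) s (ℕₚ.<ᵇ⇒< c _ (allB-last (c <ᵇ_) h q (proj₂ (T-∧⁻ (allowedFrom h q) valid))))) ⟩
    aboveThenStep c t h q s
      ∎
    where
    open ≡-Reasoning
    above : Bool
    above = allB (c <ᵇ_) (heights h q)
    move-end-guard : ∀ α ε β w y → [ α ∧ ε ∧ β ]· w *ℚ y ≡ [ α ∧ β ]· w *ℚ [ ε ]· y
    move-end-guard false ε     β w y = trans (ℚₚ.*-zeroˡ y) (sym (ℚₚ.*-zeroˡ ([ ε ]· y)))
    move-end-guard true  false β w y = trans (ℚₚ.*-zeroˡ y) (sym (ℚₚ.*-zeroʳ ([ β ]· w)))
    move-end-guard true  true  β w y = refl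
    guarded-*-cong : ∀ b w {y z} → (T b → y ≡ z) → [ b ]· w *ℚ y ≡ [ b ]· w *ℚ z
    guarded-*-cong true  w y≡z = cong (w *ℚ_) (y≡z tt)
    guarded-*-cong false w {y} {z} _ = trans (ℚₚ.*-zeroˡ y) (sym (ℚₚ.*-zeroˡ z))

  splits-single-both : ∀ (v₁ v₂ : Step → ℚ) (G : Path → ℚ) s q →
    splits (λ q′ r → splits (λ p₁ p₂ → single v₁ p₁ *ℚ G p₂) q′ *ℚ single v₂ r) (s ∷ q)
      ≡ v₁ s *ℚ splitLast (λ q′ s′ → G q′ *ℚ v₂ s′) q
  splits-single-both v₁ v₂ G s q = begin
    splits (λ q′ r → X q′ *ℚ single v₂ r) (s ∷ q)
      ≡⟨ splits-single-right v₂ X (s ∷ q) ⟩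
    splitLast (λ q′ s′ → X q′ *ℚ v₂ s′) (s ∷ q)
      ≡⟨ splitLast-∷ s q _ (λ s′ → trans (cong (_*ℚ v₂ s′) (ℚₚ.*-zeroˡ (G []))) (ℚₚ.*-zeroˡ (v₂ s′))) ⟩
    splitLast (λ q′ s′ → X (s ∷ q′) *ℚ v₂ s′) q
      ≡⟨ splitLast-cong q (λ q′ s′ → trans (cong (_*ℚ v₂ s′) (splits-single-left v₁ G s q′))
                                           (ℚₚ.*-assoc (v₁ s) (G q′) (v₂ s′))) ⟩
    splitLast (λ q′ s′ → v₁ s *ℚ (G q′ *ℚ v₂ s′)) q
      ≡⟨ splitLast-linear q (v₁ s *ℚ_) _ (ℚₚ.*-zeroʳ (v₁ s)) ⟩
    v₁ s *ℚ splitLast (λ q′ s′ → G q′ *ℚ v₂ s′) q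
      ∎
    where
    open ≡-Reasoning
    X : Path → ℚ
    X = splits (λ p₁ p₂ → single v₁ p₁ *ℚ G p₂)

  Aᵖ-decomposition : ∀ {k c t} (v₀ : Step → ℚ) (I₁ I₂ : List ℕ) (v₁ v₂ : ℕ → Step → ℚ) →
    (∀ s → prepend k s ([ next k s ≡ᵇ t ]· 1ℚ) ≡ v₀ s) →
    (∀ s (X : ℕ → ℚ) → ∑[ i₁ ← I₁ ] v₁ i₁ s *ℚ X (k + i₁) ≡ prepend k s ([ c <ᵇ next k s ]· X (next k s))) →
    (∀ e s → c < e → ∑[ i₂ ← I₂ ] [ e ≡ᵇ k + i₂ ]· v₂ i₂ s ≡ [ inS e s ∧ (next e s ≡ᵇ t) ]· coefS s) →
    ∀ p → Aᵖ k c t p ≡ single v₀ p +ℚ ∑[ i₁ ← I₁ ] ∑[ i₂ ← I₂ ]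
            splits (λ q r → splits (λ p₁ p₂ → single (v₁ i₁) p₁ *ℚ Fᵖ (c + 1) (k + i₁) (k + i₂) p₂) q
                            *ℚ single (v₂ i₂) r) p
  Aᵖ-decomposition {k} {c} {t} v₀ I₁ I₂ v₁ v₂ single-step first-step last-step p
    rewrite ℕₚ.+-comm c 1 = decompose p
    where
    open ≡-Reasoning
    middle : ℕ → ℕ → Path → ℚ
    middle i₁ i₂ = splits (λ q r → splits (λ p₁ p₂ → single (v₁ i₁) p₁ *ℚ Fᵖ (suc c) (k + i₁) (k + i₂) p₂) q
                                   *ℚ single (v₂ i₂) r)

    decompose : ∀ p → Aᵖ k c t p ≡ single v₀ p +ℚ ∑[ i₁ ← I₁ ] ∑[ i₂ ← I₂ ] middle i₁ i₂ p
    decompose [] = begin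
      Aᵖ k c t []
        ≡⟨ Aᵖ-[] k c t ⟩
      0ℚ
        ≡⟨ sym (trans (ℚₚ.+-identityˡ _) (∑-zero I₁ λ i₁ → ∑-zero I₂ λ i₂ →
             ℚₚ.*-zeroʳ (splits (λ p₁ p₂ → single (v₁ i₁) p₁ *ℚ Fᵖ (suc c) (k + i₁) (k + i₂) p₂) []))) ⟩
      0ℚ +ℚ ∑[ i₁ ← I₁ ] ∑[ i₂ ← I₂ ] middle i₁ i₂ []
        ∎
    decompose (s ∷ q) = begin
      Aᵖ k c t (s ∷ q)
        ≡⟨ Aᵖ-∷ k c t s q ⟩
      prepend k s ([ isNil q ]· [ k′ ≡ᵇ t ]· 1ℚ +ℚ [ c <ᵇ k′ ]· Aᵖ k′ c t q)
        ≡⟨ prepend-+ k s _ _ ⟩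
      prepend k s ([ isNil q ]· [ k′ ≡ᵇ t ]· 1ℚ) +ℚ prepend k s ([ c <ᵇ k′ ]· Aᵖ k′ c t q)
        ≡⟨ cong₂ _+ℚ_ (trans (prepend-[]· k s (isNil q) _) (cong ([ isNil q ]·_) (single-step s)))
                      (cong (prepend k s) (trans (sym ([]·-absorb (c <ᵇ k′) (c <ᵇ k′) (Aᵖ k′ c t q) id))
                                                 (cong ([ c <ᵇ k′ ]·_) (Aᵖ-splitLast q k′ c t)))) ⟩
      [ isNil q ]· v₀ s +ℚ prepend k s ([ c <ᵇ k′ ]· splitLast (aboveThenStep c t k′) q)
        ≡⟨ cong₂ _+ℚ_ (sym (single-∷ v₀ s q)) (sym (first-step s (λ h → splitLast (aboveThenStep c t h) q))) ⟩
      single v₀ (s ∷ q) +ℚ ∑[ i₁ ← I₁ ] v₁ i₁ s *ℚ splitLast (aboveThenStep c t (k + i₁)) q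
        ≡⟨ cong (single v₀ (s ∷ q) +ℚ_) (∑-cong I₁ λ i₁ → sym (through-middle i₁)) ⟩
      single v₀ (s ∷ q) +ℚ ∑[ i₁ ← I₁ ] ∑[ i₂ ← I₂ ] middle i₁ i₂ (s ∷ q)
        ∎
      where
      k′ : ℕ
      k′ = next k s
      through-middle : ∀ i₁ →
        ∑[ i₂ ← I₂ ] middle i₁ i₂ (s ∷ q) ≡ v₁ i₁ s *ℚ splitLast (aboveThenStep c t (k + i₁)) q
      through-middle i₁ = begin
        ∑[ i₂ ← I₂ ] middle i₁ i₂ (s ∷ q)
          ≡⟨ ∑-cong I₂ (λ i₂ → splits-single-both (v₁ i₁) (v₂ i₂) (Fᵖ (suc c) (k + i₁) (k + i₂)) s q) ⟩
        ∑[ i₂ ← I₂ ] v₁ i₁ s *ℚ splitLast (λ q′ s′ → Fᵖ (suc c) (k + i₁) (k + i₂) q′ *ℚ v₂ i₂ s′) q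
          ≡⟨ ∑-*ˡ I₂ (v₁ i₁ s) _ ⟩
        v₁ i₁ s *ℚ (∑[ i₂ ← I₂ ] splitLast (λ q′ s′ → Fᵖ (suc c) (k + i₁) (k + i₂) q′ *ℚ v₂ i₂ s′) q)
          ≡⟨ cong (v₁ i₁ s *ℚ_) (trans (sym (splitLast-∑ q I₂ _))
               (splitLast-cong q (Fᵖ-then-step I₂ v₂ last-step (k + i₁)))) ⟩
        v₁ i₁ s *ℚ splitLast (aboveThenStep c t (k + i₁)) q
          ∎

  -- Single steps in terms of the coefficients of Q

  sj≤J : ∀ s → toℕ (sj s) ≤ J
  sj≤J s = ℕₚ.≤-pred (Finₚ.toℕ<n (sj s))

  sℓ≤L : ∀ s → toℕ (sℓ s) ≤ L
  sℓ≤L s = ℕₚ.≤-pred (Finₚ.toℕ<n (sℓ s))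

  inS-coef : ∀ h s b → [ inS h s ∧ b ]· coefS s ≡ [ (toℕ (sj s) ≤ᵇ h) ∧ b ]· coefS s
  inS-coef h s b with toℕ (sj s) ≤ᵇ h | coefS s ℚ.≟ 0ℚ
  ... | false | _      = refl
  ... | true  | no _   = refl
  ... | true  | yes c≡0 with b
  ...   | true  = sym c≡0
  ...   | false = refl

  prepend-guard : ∀ h s b x → prepend h s ([ b ]· x) ≡ [ (toℕ (sj s) ≤ᵇ h) ∧ b ]· (coefS s *ℚ x)
  prepend-guard h s b x = begin
    [ inS h s ]· (coefS s *ℚ [ b ]· x)
      ≡⟨ cong ([ inS h s ]·_) (trans (sym ([]·-*ˡ b (coefS s) x)) ([]·-*ʳ b (coefS s) x)) ⟩
    [ inS h s ]· ([ b ]· coefS s *ℚ x)   ≡⟨ []·-*ʳ (inS h s) _ x ⟩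
    [ inS h s ]· [ b ]· coefS s *ℚ x     ≡⟨ cong (_*ℚ x) (trans (sym ([]·-∧ (inS h s) b _)) (inS-coef h s b)) ⟩
    [ (toℕ (sj s) ≤ᵇ h) ∧ b ]· coefS s *ℚ x ≡⟨ sym ([]·-*ʳ _ (coefS s) x) ⟩
    [ (toℕ (sj s) ≤ᵇ h) ∧ b ]· (coefS s *ℚ x) ∎
    where open ≡-Reasoning

  single-step-up : ∀ k i s →
    prepend k s ([ next k s ≡ᵇ k + i ]· 1ℚ) ≡ stepWeight (k ⊓ J) (λ ℓ j → ℓ ≡ᵇ j + i) s
  single-step-up k i s =
    trans (prepend-guard k s _ 1ℚ)
          (trans (cong ([ (j ≤ᵇ k) ∧ (next k s ≡ᵇ k + i) ]·_) (ℚₚ.*-identityʳ (coefS s)))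
                 (cong ([_]· coefS s) (T-ext to from)))
    where
    open +-*-Solver
    j ℓ : ℕ
    j = toℕ (sj s)
    ℓ = toℕ (sℓ s)
    to : T ((j ≤ᵇ k) ∧ (next k s ≡ᵇ k + i)) → T ((j ≤ᵇ k ⊓ J) ∧ (ℓ ≡ᵇ j + i))
    to t with T-∧⁻ (j ≤ᵇ k) t
    ... | j≤k , lands =
      let j≤k′ = ℕₚ.≤ᵇ⇒≤ j k j≤k in
      T-∧⁺ (ℕₚ.≤⇒≤ᵇ (ℕₚ.⊓-glb j≤k′ (sj≤J s)))
           (ℕₚ.≡⇒≡ᵇ ℓ (j + i) (ℕₚ.+-cancelˡ-≡ k ℓ (j + i)
             (trans (∸+≡⇒ j≤k′ (ℕₚ.≡ᵇ⇒≡ _ _ lands))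
                    (solve 3 (λ k i j → (k :+ i) :+ j := k :+ (j :+ i)) refl k i j))))
    from : T ((j ≤ᵇ k ⊓ J) ∧ (ℓ ≡ᵇ j + i)) → T ((j ≤ᵇ k) ∧ (next k s ≡ᵇ k + i))
    from t with T-∧⁻ (j ≤ᵇ k ⊓ J) t
    ... | j≤k⊓J , rises =
      let j≤k = ℕₚ.≤-trans (ℕₚ.≤ᵇ⇒≤ j _ j≤k⊓J) (ℕₚ.m⊓n≤m k J) in
      T-∧⁺ (ℕₚ.≤⇒≤ᵇ j≤k)
           (ℕₚ.≡⇒≡ᵇ _ _ (∸+≡⇐ j≤k (trans (cong (_+_ k) (ℕₚ.≡ᵇ⇒≡ ℓ (j + i) rises))
                                           (solve 3 (λ k i j → k :+ (j :+ i) := (k :+ i) :+ j) refl k i j))))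

  single-step-down : ∀ k i s → i ≤ k →
    prepend k s ([ next k s ≡ᵇ k ∸ i ]· 1ℚ) ≡ stepWeight (k ⊓ J) (λ ℓ j → j ≡ᵇ ℓ + i) s
  single-step-down k i s i≤k =
    trans (prepend-guard k s _ 1ℚ)
          (trans (cong ([ (j ≤ᵇ k) ∧ (next k s ≡ᵇ k ∸ i) ]·_) (ℚₚ.*-identityʳ (coefS s)))
                 (cong ([_]· coefS s) (T-ext to from)))
    where
    open +-*-Solver
    j ℓ : ℕ
    j = toℕ (sj s)
    ℓ = toℕ (sℓ s)
    k≡k∸i+i : k ≡ k ∸ i + i
    k≡k∸i+i = sym (ℕₚ.m∸n+n≡m i≤k)
    to : T ((j ≤ᵇ k) ∧ (next k s ≡ᵇ k ∸ i)) → T ((j ≤ᵇ k ⊓ J) ∧ (j ≡ᵇ ℓ + i))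
    to t with T-∧⁻ (j ≤ᵇ k) t
    ... | j≤k , lands =
      let j≤k′ = ℕₚ.≤ᵇ⇒≤ j k j≤k
          k+ℓ≡k∸i+j = ∸+≡⇒ j≤k′ (ℕₚ.≡ᵇ⇒≡ _ _ lands) in
      T-∧⁺ (ℕₚ.≤⇒≤ᵇ (ℕₚ.⊓-glb j≤k′ (sj≤J s)))
           (ℕₚ.≡⇒≡ᵇ j (ℓ + i) (ℕₚ.+-cancelˡ-≡ (k ∸ i) j (ℓ + i) (begin
             k ∸ i + j         ≡⟨ sym k+ℓ≡k∸i+j ⟩
             k + ℓ             ≡⟨ cong (_+ ℓ) k≡k∸i+i ⟩
             k ∸ i + i + ℓ     ≡⟨ solve 3 (λ a i ℓ → (a :+ i) :+ ℓ := a :+ (ℓ :+ i)) refl (k ∸ i) i ℓ ⟩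
             k ∸ i + (ℓ + i)   ∎)))
      where open ≡-Reasoning
    from : T ((j ≤ᵇ k ⊓ J) ∧ (j ≡ᵇ ℓ + i)) → T ((j ≤ᵇ k) ∧ (next k s ≡ᵇ k ∸ i))
    from t with T-∧⁻ (j ≤ᵇ k ⊓ J) t
    ... | j≤k⊓J , falls =
      let j≤k = ℕₚ.≤-trans (ℕₚ.≤ᵇ⇒≤ j _ j≤k⊓J) (ℕₚ.m⊓n≤m k J) in
      T-∧⁺ (ℕₚ.≤⇒≤ᵇ j≤k) (ℕₚ.≡⇒≡ᵇ _ _ (∸+≡⇐ j≤k (begin
        k + ℓ             ≡⟨ cong (_+ ℓ) k≡k∸i+i ⟩
        k ∸ i + i + ℓ     ≡⟨ solve 3 (λ a i ℓ → (a :+ i) :+ ℓ := a :+ (ℓ :+ i)) refl (k ∸ i) i ℓ ⟩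
        k ∸ i + (ℓ + i)   ≡⟨ cong (_+_ (k ∸ i)) (sym (ℕₚ.≡ᵇ⇒≡ j (ℓ + i) falls)) ⟩
        k ∸ i + j         ∎)))
      where open ≡-Reasoning

  first-step-up : ∀ k i s (X : ℕ → ℚ) →
    ∑[ i₁ ← range (suc i) L ] stepWeight (k ⊓ J) (λ ℓ j → ℓ ≡ᵇ j + i₁) s *ℚ X (k + i₁)
      ≡ prepend k s ([ k + i <ᵇ next k s ]· X (next k s))
  first-step-up k i s X = begin
    ∑[ i₁ ← range (suc i) L ] [ (j ≤ᵇ k ⊓ J) ∧ (ℓ ≡ᵇ j + i₁) ]· coefS s *ℚ X (k + i₁)
      ≡⟨ ∑-cong (range (suc i) L) (λ i₁ → trans (sym ([]·-*ʳ _ (coefS s) (X (k + i₁))))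
           (trans ([]·-∧ (j ≤ᵇ k ⊓ J) (ℓ ≡ᵇ j + i₁) _) ([]·-comm (j ≤ᵇ k ⊓ J) (ℓ ≡ᵇ j + i₁) _))) ⟩
    ∑[ i₁ ← range (suc i) L ] [ ℓ ≡ᵇ j + i₁ ]· [ j ≤ᵇ k ⊓ J ]· (coefS s *ℚ X (k + i₁))
      ≡⟨ ∑-range-shift (suc i) L j ℓ (λ i₁ → [ j ≤ᵇ k ⊓ J ]· (coefS s *ℚ X (k + i₁))) ⟩
    [ j ≤ᵇ ℓ ]· [ (suc i ≤ᵇ ℓ ∸ j) ∧ (ℓ ∸ j <ᵇ suc L) ]· [ j ≤ᵇ k ⊓ J ]· (coefS s *ℚ X (k + (ℓ ∸ j)))
      ≡⟨ sym (trans ([]·-∧ (j ≤ᵇ ℓ) _ _)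
                    (cong ([ j ≤ᵇ ℓ ]·_) ([]·-∧ ((suc i ≤ᵇ ℓ ∸ j) ∧ (ℓ ∸ j <ᵇ suc L)) _ _))) ⟩
    [ (j ≤ᵇ ℓ) ∧ ((suc i ≤ᵇ ℓ ∸ j) ∧ (ℓ ∸ j <ᵇ suc L)) ∧ (j ≤ᵇ k ⊓ J) ]· (coefS s *ℚ X (k + (ℓ ∸ j)))
      ≡⟨ []·-cong₂ (T-ext to from) (λ t → cong (λ h → coefS s *ℚ X h) (landing t)) ⟩
    [ (j ≤ᵇ k) ∧ (k + i <ᵇ next k s) ]· (coefS s *ℚ X (next k s))
      ≡⟨ sym (prepend-guard k s _ _) ⟩
    prepend k s ([ k + i <ᵇ next k s ]· X (next k s))
      ∎
    where
    open ≡-Reasoning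
    open +-*-Solver
    j ℓ : ℕ
    j = toℕ (sj s)
    ℓ = toℕ (sℓ s)
    next≡ : j ≤ k → j ≤ ℓ → k + (ℓ ∸ j) ≡ next k s
    next≡ j≤k j≤ℓ = trans (sym (ℕₚ.+-∸-assoc k j≤ℓ)) (ℕₚ.+-∸-comm ℓ j≤k)
    rises⇒j+i<ℓ : (j≤k : j ≤ k) → k + i < next k s → j + i < ℓ
    rises⇒j+i<ℓ j≤k rises = ℕₚ.+-cancelˡ-< k (j + i) ℓ
      (subst₂ _<_ (solve 3 (λ k i j → (k :+ i) :+ j := k :+ (j :+ i)) refl k i j) (∸+-cancel ℓ j≤k)
                  (ℕₚ.+-monoˡ-< j rises))
    landing : T ((j ≤ᵇ k) ∧ (k + i <ᵇ next k s)) → k + (ℓ ∸ j) ≡ next k s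
    landing t with T-∧⁻ (j ≤ᵇ k) t
    ... | j≤k , rises =
      next≡ j≤k′ (ℕₚ.≤-trans (ℕₚ.m≤m+n j i) (ℕₚ.<⇒≤ (rises⇒j+i<ℓ j≤k′ (ℕₚ.<ᵇ⇒< (k + i) _ rises))))
      where j≤k′ = ℕₚ.≤ᵇ⇒≤ j k j≤k
    to : T ((j ≤ᵇ ℓ) ∧ ((suc i ≤ᵇ ℓ ∸ j) ∧ (ℓ ∸ j <ᵇ suc L)) ∧ (j ≤ᵇ k ⊓ J))
       → T ((j ≤ᵇ k) ∧ (k + i <ᵇ next k s))
    to t with T-∧⁻³ (j ≤ᵇ ℓ) ((suc i ≤ᵇ ℓ ∸ j) ∧ (ℓ ∸ j <ᵇ suc L)) t
    ... | j≤ℓ , bounds , j≤k⊓J =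
      let j≤k = ℕₚ.≤-trans (ℕₚ.≤ᵇ⇒≤ j _ j≤k⊓J) (ℕₚ.m⊓n≤m k J)
          i<ℓ∸j = ℕₚ.≤ᵇ⇒≤ (suc i) _ (proj₁ (T-∧⁻ (suc i ≤ᵇ ℓ ∸ j) bounds)) in
      T-∧⁺ (ℕₚ.≤⇒≤ᵇ j≤k)
           (ℕₚ.<⇒<ᵇ (subst (k + i <_) (next≡ j≤k (ℕₚ.≤ᵇ⇒≤ j ℓ j≤ℓ)) (ℕₚ.+-monoʳ-< k i<ℓ∸j)))
    from : T ((j ≤ᵇ k) ∧ (k + i <ᵇ next k s))
         → T ((j ≤ᵇ ℓ) ∧ ((suc i ≤ᵇ ℓ ∸ j) ∧ (ℓ ∸ j <ᵇ suc L)) ∧ (j ≤ᵇ k ⊓ J))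
    from t with T-∧⁻ (j ≤ᵇ k) t
    ... | j≤k , rises = T-∧⁺ (ℕₚ.≤⇒≤ᵇ j≤ℓ) (T-∧⁺ (T-∧⁺ (ℕₚ.≤⇒≤ᵇ i<ℓ∸j) (ℕₚ.<⇒<ᵇ (s≤s ℓ∸j≤L)))
                                                  (ℕₚ.≤⇒≤ᵇ (ℕₚ.⊓-glb j≤k′ (sj≤J s))))
      where
      j≤k′ = ℕₚ.≤ᵇ⇒≤ j k j≤k
      j+i<ℓ : j + i < ℓ
      j+i<ℓ = rises⇒j+i<ℓ j≤k′ (ℕₚ.<ᵇ⇒< (k + i) _ rises)
      j≤ℓ : j ≤ ℓ
      j≤ℓ = ℕₚ.≤-trans (ℕₚ.m≤m+n j i) (ℕₚ.<⇒≤ j+i<ℓ)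
      i<ℓ∸j : i < ℓ ∸ j
      i<ℓ∸j = ℕₚ.+-cancelˡ-< j i (ℓ ∸ j) (subst (j + i <_) (sym (ℕₚ.m+[n∸m]≡n j≤ℓ)) j+i<ℓ)
      ℓ∸j≤L : ℓ ∸ j ≤ L
      ℓ∸j≤L = ℕₚ.≤-trans (ℕₚ.m∸n≤m ℓ j) (sℓ≤L s)

  ∑-range-last-step : ∀ lo hi {k e} (m : ℕ → ℕ) (cnd : ℕ → ℕ → ℕ → Bool) s → k ≤ e →
    ∑[ i₂ ← range lo hi ] [ e ≡ᵇ k + i₂ ]· stepWeight (m i₂) (cnd i₂) s
      ≡ [ ((lo ≤ᵇ e ∸ k) ∧ (e ∸ k <ᵇ suc hi))
          ∧ (toℕ (sj s) ≤ᵇ m (e ∸ k)) ∧ cnd (e ∸ k) (toℕ (sℓ s)) (toℕ (sj s)) ]· coefS s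
  ∑-range-last-step lo hi {k} {e} m cnd s k≤e =
    trans (∑-range-shift lo hi k e (λ i₂ → stepWeight (m i₂) (cnd i₂) s))
   (trans ([]·-true _ (ℕₚ.≤⇒≤ᵇ k≤e))
          (sym ([]·-∧ ((lo ≤ᵇ e ∸ k) ∧ (e ∸ k <ᵇ suc hi)) _ (coefS s))))

  last-step-up : ∀ k i e s → k + i < e →
    ∑[ i₂ ← range (suc i) (i + J) ] [ e ≡ᵇ k + i₂ ]· stepWeight ((k + i₂) ⊓ J) (λ ℓ j → j ≡ᵇ ℓ + (i₂ ∸ i)) s
      ≡ [ inS e s ∧ (next e s ≡ᵇ k + i) ]· coefS s
  last-step-up k i e s k+i<e =
    trans (∑-range-last-step (suc i) (i + J) (λ i₂ → (k + i₂) ⊓ J) (λ i₂ ℓ j → j ≡ᵇ ℓ + (i₂ ∸ i)) s k≤e)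
   (trans (cong ([_]· coefS s) (T-ext to from)) (sym (inS-coef e s _)))
    where
    open +-*-Solver
    j ℓ d : ℕ
    j = toℕ (sj s)
    ℓ = toℕ (sℓ s)
    d = e ∸ k
    k≤e : k ≤ e
    k≤e = ℕₚ.≤-trans (ℕₚ.m≤m+n k i) (ℕₚ.<⇒≤ k+i<e)
    k+d≡e : k + d ≡ e
    k+d≡e = ℕₚ.m+[n∸m]≡n k≤e
    i<d : i < d
    i<d = ℕₚ.+-cancelˡ-< k i d (subst (k + i <_) (sym k+d≡e) k+i<e)
    e+ℓ≡ : e + ℓ ≡ (k + i) + (ℓ + (d ∸ i))
    e+ℓ≡ = begin
      e + ℓ                    ≡⟨ cong (_+ ℓ) (sym k+d≡e) ⟩
      k + d + ℓ                ≡⟨ cong (λ x → k + x + ℓ) (sym (ℕₚ.m+[n∸m]≡n (ℕₚ.<⇒≤ i<d))) ⟩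
      k + (i + (d ∸ i)) + ℓ
        ≡⟨ solve 4 (λ k i x ℓ → k :+ (i :+ x) :+ ℓ := (k :+ i) :+ (ℓ :+ x)) refl k i (d ∸ i) ℓ ⟩
      (k + i) + (ℓ + (d ∸ i))  ∎
      where open ≡-Reasoning
    to : T (((suc i ≤ᵇ d) ∧ (d <ᵇ suc (i + J))) ∧ (j ≤ᵇ (k + d) ⊓ J) ∧ (j ≡ᵇ ℓ + (d ∸ i)))
       → T ((j ≤ᵇ e) ∧ (next e s ≡ᵇ k + i))
    to t with T-∧⁻³ ((suc i ≤ᵇ d) ∧ (d <ᵇ suc (i + J))) (j ≤ᵇ (k + d) ⊓ J) t
    ... | _ , j≤k+d⊓J , j≡ =
      let j≤e = subst (j ≤_) k+d≡e (ℕₚ.≤-trans (ℕₚ.≤ᵇ⇒≤ j _ j≤k+d⊓J) (ℕₚ.m⊓n≤m (k + d) J)) in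
      T-∧⁺ (ℕₚ.≤⇒≤ᵇ j≤e) (ℕₚ.≡⇒≡ᵇ _ _ (lands⇐ j≤e e+ℓ≡ (ℕₚ.≡ᵇ⇒≡ j _ j≡)))
    from : T ((j ≤ᵇ e) ∧ (next e s ≡ᵇ k + i))
         → T (((suc i ≤ᵇ d) ∧ (d <ᵇ suc (i + J))) ∧ (j ≤ᵇ (k + d) ⊓ J) ∧ (j ≡ᵇ ℓ + (d ∸ i)))
    from t with T-∧⁻ (j ≤ᵇ e) t
    ... | j≤e , lands = T-∧⁺ (T-∧⁺ (ℕₚ.≤⇒≤ᵇ i<d) (ℕₚ.<⇒<ᵇ (s≤s d≤i+J)))
                             (T-∧⁺ (ℕₚ.≤⇒≤ᵇ (ℕₚ.⊓-glb (subst (j ≤_) (sym k+d≡e) j≤e′) (sj≤J s)))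
                                   (ℕₚ.≡⇒≡ᵇ j _ j≡))
      where
      j≤e′ = ℕₚ.≤ᵇ⇒≤ j e j≤e
      j≡ : j ≡ ℓ + (d ∸ i)
      j≡ = lands⇒ j≤e′ e+ℓ≡ (ℕₚ.≡ᵇ⇒≡ _ _ lands)
      d≤i+J : d ≤ i + J
      d≤i+J = subst (_≤ i + J) (ℕₚ.m+[n∸m]≡n (ℕₚ.<⇒≤ i<d))
        (ℕₚ.+-monoʳ-≤ i (ℕₚ.≤-trans (subst (d ∸ i ≤_) (sym j≡) (ℕₚ.m≤n+m (d ∸ i) ℓ)) (sj≤J s)))

  last-step-down : ∀ k i e s → k < e → i ≤ k →
    ∑[ i₂ ← range 1 (J ∸ i) ] [ e ≡ᵇ k + i₂ ]· stepWeight ((k + i₂) ⊓ J) (λ ℓ j → j ≡ᵇ ℓ + (i + i₂)) s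
      ≡ [ inS e s ∧ (next e s ≡ᵇ k ∸ i) ]· coefS s
  last-step-down k i e s k<e i≤k =
    trans (∑-range-last-step 1 (J ∸ i) (λ i₂ → (k + i₂) ⊓ J) (λ i₂ ℓ j → j ≡ᵇ ℓ + (i + i₂)) s (ℕₚ.<⇒≤ k<e))
   (trans (cong ([_]· coefS s) (T-ext to from)) (sym (inS-coef e s _)))
    where
    open +-*-Solver
    j ℓ d : ℕ
    j = toℕ (sj s)
    ℓ = toℕ (sℓ s)
    d = e ∸ k
    k+d≡e : k + d ≡ e
    k+d≡e = ℕₚ.m+[n∸m]≡n (ℕₚ.<⇒≤ k<e)
    0<d : 0 < d
    0<d = ℕₚ.m<n⇒0<n∸m k<e
    e+ℓ≡ : e + ℓ ≡ (k ∸ i) + (ℓ + (i + d))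
    e+ℓ≡ = begin
      e + ℓ                    ≡⟨ cong (_+ ℓ) (sym k+d≡e) ⟩
      k + d + ℓ                ≡⟨ cong (λ x → x + d + ℓ) (sym (ℕₚ.m∸n+n≡m i≤k)) ⟩
      k ∸ i + i + d + ℓ
        ≡⟨ solve 4 (λ a i d ℓ → a :+ i :+ d :+ ℓ := a :+ (ℓ :+ (i :+ d))) refl (k ∸ i) i d ℓ ⟩
      (k ∸ i) + (ℓ + (i + d))  ∎
      where open ≡-Reasoning
    to : T (((1 ≤ᵇ d) ∧ (d <ᵇ suc (J ∸ i))) ∧ (j ≤ᵇ (k + d) ⊓ J) ∧ (j ≡ᵇ ℓ + (i + d)))
       → T ((j ≤ᵇ e) ∧ (next e s ≡ᵇ k ∸ i))
    to t with T-∧⁻³ ((1 ≤ᵇ d) ∧ (d <ᵇ suc (J ∸ i))) (j ≤ᵇ (k + d) ⊓ J) t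
    ... | _ , j≤k+d⊓J , j≡ =
      let j≤e = subst (j ≤_) k+d≡e (ℕₚ.≤-trans (ℕₚ.≤ᵇ⇒≤ j _ j≤k+d⊓J) (ℕₚ.m⊓n≤m (k + d) J)) in
      T-∧⁺ (ℕₚ.≤⇒≤ᵇ j≤e) (ℕₚ.≡⇒≡ᵇ _ _ (lands⇐ j≤e e+ℓ≡ (ℕₚ.≡ᵇ⇒≡ j _ j≡)))
    from : T ((j ≤ᵇ e) ∧ (next e s ≡ᵇ k ∸ i))
         → T (((1 ≤ᵇ d) ∧ (d <ᵇ suc (J ∸ i))) ∧ (j ≤ᵇ (k + d) ⊓ J) ∧ (j ≡ᵇ ℓ + (i + d)))
    from t with T-∧⁻ (j ≤ᵇ e) t
    ... | j≤e , lands = T-∧⁺ (T-∧⁺ (ℕₚ.≤⇒≤ᵇ 0<d) (ℕₚ.<⇒<ᵇ (s≤s d≤J∸i)))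
                             (T-∧⁺ (ℕₚ.≤⇒≤ᵇ (ℕₚ.⊓-glb (subst (j ≤_) (sym k+d≡e) j≤e′) (sj≤J s)))
                                   (ℕₚ.≡⇒≡ᵇ j _ j≡))
      where
      j≤e′ = ℕₚ.≤ᵇ⇒≤ j e j≤e
      j≡ : j ≡ ℓ + (i + d)
      j≡ = lands⇒ j≤e′ e+ℓ≡ (ℕₚ.≡ᵇ⇒≡ _ _ lands)
      d≤J∸i : d ≤ J ∸ i
      d≤J∸i = subst (_≤ J ∸ i) (ℕₚ.m+n∸m≡n i d)
        (ℕₚ.∸-monoˡ-≤ i (ℕₚ.≤-trans (subst (i + d ≤_) (sym j≡) (ℕₚ.m≤n+m (i + d) ℓ)) (sj≤J s)))

  A-recurrence : ∀ k i →
    A k i ≈ₛ SQ (k ⊓ J) (λ ℓ j → ℓ ≡ᵇ j + i)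
             ⊕ ΣS (range (suc i) L) (λ i₁ → ΣS (range (suc i) (i + J)) (λ i₂ →
                 SQ (k ⊓ J) (λ ℓ₁ j₁ → ℓ₁ ≡ᵇ j₁ + i₁)
                 ⊛ F (k + i + 1) (k + i₁) (k + i₂)
                 ⊛ SQ ((k + i₂) ⊓ J) (λ ℓ₂ j₂ → j₂ ≡ᵇ ℓ₂ + (i₂ ∸ i))))
  A-recurrence k i =
    ≐-unique (A-≐ k i)
      (≐-⊕ (SQ-≐ (k ⊓ J) cnd₀) (≐-ΣS I₁ λ i₁ → ≐-ΣS I₂ λ i₂ →
        ≐-⊛ (≐-⊛ (SQ-≐ (k ⊓ J) (cnd₁ i₁)) (F-≐ (k + i + 1) (k + i₁) (k + i₂)))
            (SQ-≐ ((k + i₂) ⊓ J) (cnd₂ i₂))))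
      (Aᵖ-decomposition (stepWeight (k ⊓ J) cnd₀) I₁ I₂
        (λ i₁ → stepWeight (k ⊓ J) (cnd₁ i₁)) (λ i₂ → stepWeight ((k + i₂) ⊓ J) (cnd₂ i₂))
        (single-step-up k i) (first-step-up k i) (λ e s → last-step-up k i e s))
    where
    I₁ I₂ : List ℕ
    I₁ = range (suc i) L
    I₂ = range (suc i) (i + J)
    cnd₀ : ℕ → ℕ → Bool
    cnd₀ ℓ j = ℓ ≡ᵇ j + i
    cnd₁ cnd₂ : ℕ → ℕ → ℕ → Bool
    cnd₁ i₁ ℓ j = ℓ ≡ᵇ j + i₁
    cnd₂ i₂ ℓ j = j ≡ᵇ ℓ + (i₂ ∸ i)

  Abar-recurrence : ∀ k i → i ≤ k →
    Abar k i ≈ₛ SQ (k ⊓ J) (λ ℓ j → j ≡ᵇ ℓ + i)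
                ⊕ ΣS (range 1 L) (λ i₁ → ΣS (range 1 (J ∸ i)) (λ i₂ →
                    SQ (k ⊓ J) (λ ℓ₁ j₁ → ℓ₁ ≡ᵇ j₁ + i₁)
                    ⊛ F (k + 1) (k + i₁) (k + i₂)
                    ⊛ SQ ((k + i₂) ⊓ J) (λ ℓ₂ j₂ → j₂ ≡ᵇ ℓ₂ + (i + i₂))))
  Abar-recurrence k i i≤k =
    ≐-unique (Abar-≐ k i)
      (≐-⊕ (SQ-≐ (k ⊓ J) cnd₀) (≐-ΣS I₁ λ i₁ → ≐-ΣS I₂ λ i₂ →
        ≐-⊛ (≐-⊛ (SQ-≐ (k ⊓ J) (cnd₁ i₁)) (F-≐ (k + 1) (k + i₁) (k + i₂)))
            (SQ-≐ ((k + i₂) ⊓ J) (cnd₂ i₂))))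
      (Aᵖ-decomposition (stepWeight (k ⊓ J) cnd₀) I₁ I₂
        (λ i₁ → stepWeight (k ⊓ J) (cnd₁ i₁)) (λ i₂ → stepWeight ((k + i₂) ⊓ J) (cnd₂ i₂))
        (λ s → single-step-down k i s i≤k)
        (λ s X → trans (first-step-up k 0 s X)
                       (cong (λ c → prepend k s ([ c <ᵇ next k s ]· X (next k s))) (ℕₚ.+-identityʳ k)))
        (λ e s k<e → last-step-down k i e s k<e i≤k))
    where
    I₁ I₂ : List ℕ
    I₁ = range 1 L
    I₂ = range 1 (J ∸ i)
    cnd₀ : ℕ → ℕ → Bool
    cnd₀ ℓ j = j ≡ᵇ ℓ + i
    cnd₁ cnd₂ : ℕ → ℕ → ℕ → Bool
    cnd₁ i₁ ℓ j = ℓ ≡ᵇ j + i₁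
    cnd₂ i₂ ℓ j = j ≡ᵇ ℓ + (i + i₂)

  dUnder-≤ : ∀ m {d} → dUnder m ≡ just d → d ℤ.≤ + m
  dUnder-≤ m = maxℤ-≤ (+ m) (valuesOver m (λ ℓ j → + j ℤ.- + ℓ))
    (concat⁺ (map⁺ (universal (λ ℓ → concat⁺ (map⁺ (universal (bounded ℓ) (allFin (suc J))))) (allFin (suc L)))))
    where
    bounded : ∀ ℓ j → All (ℤ._≤ + m)
      (if (toℕ j ≤ᵇ m) ∧ polyNonzero ℓ j then (+ toℕ j ℤ.- + toℕ ℓ) ∷ [] else [])
    bounded ℓ j with (toℕ j ≤ᵇ m) ∧ polyNonzero ℓ j in guard
    ... | false = []
    ... | true  = ℤₚ.≤-trans (ℤₚ.i-j≤i (+ toℕ j) (+ toℕ ℓ)) (ℤ.+≤+ j≤m) ∷ []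
      where j≤m = ℕₚ.≤ᵇ⇒≤ (toℕ j) m (proj₁ (T-∧⁻ (toℕ j ≤ᵇ m) (subst T (sym guard) tt)))

lemma2 : (L J : ℕ) → 1 ≤ L → (Q : Fin (suc L) → Fin (suc J) → List ℚ)
  → (∀ ℓ j → All (0ℚ ℚ.≤_) (Q ℓ j))
  → let open Walks L J Q in
    (∀ k k₁ → k ≤ k₁ →
      F k k₁ k₁ ≈ₛ oneₛ ⊕ ΣS (range k k₁) (λ m → Abar k₁ (k₁ ∸ m) ⊛ F k m k₁))
  × (∀ k k₁ k₂ → k ≤ k₁ → k₁ < k₂ →
      F k k₁ k₂ ≈ₛ ΣS (range k k₁) (λ m → Abar k₁ (k₁ ∸ m) ⊛ F k m k₂)
                   ⊕ ΣS (range (suc k₁) k₂) (λ m → A k₁ (m ∸ k₁) ⊛ F m m k₂))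
  × (∀ k k₁ k₂ → k ≤ k₂ → k₂ < k₁ →
      F k k₁ k₂ ≈ₛ ΣS (range k k₁) (λ m → Abar k₁ (k₁ ∸ m) ⊛ F k m k₂))
  × (∀ k i → (∃ λ d → dOver (k ⊓ J) ≡ just d × + i ℤ.≤ d) →
      A k i ≈ₛ SQ (k ⊓ J) (λ ℓ j → ℓ Data.Nat.≡ᵇ j + i)
               ⊕ ΣS (range (suc i) L) (λ i₁ → ΣS (range (suc i) (i + J)) (λ i₂ →
                   SQ (k ⊓ J) (λ ℓ₁ j₁ → ℓ₁ Data.Nat.≡ᵇ j₁ + i₁)
                   ⊛ F (k + i + 1) (k + i₁) (k + i₂)
                   ⊛ SQ ((k + i₂) ⊓ J) (λ ℓ₂ j₂ → j₂ Data.Nat.≡ᵇ ℓ₂ + (i₂ ∸ i)))))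
  × (∀ k i → (∃ λ d → dUnder (k ⊓ J) ≡ just d × + i ℤ.≤ d) →
      Abar k i ≈ₛ SQ (k ⊓ J) (λ ℓ j → j Data.Nat.≡ᵇ ℓ + i)
               ⊕ ΣS (range 1 L) (λ i₁ → ΣS (range 1 (J ∸ i)) (λ i₂ →
                   SQ (k ⊓ J) (λ ℓ₁ j₁ → ℓ₁ Data.Nat.≡ᵇ j₁ + i₁)
                   ⊛ F (k + 1) (k + i₁) (k + i₂)
                   ⊛ SQ ((k + i₂) ⊓ J) (λ ℓ₂ j₂ → j₂ Data.Nat.≡ᵇ ℓ₂ + (i + i₂)))))
lemma2 L J _ Q _ =
    F-recurrence-diagonal
  , F-recurrence-up
  , F-recurrence-down
  , (λ k i _ → A-recurrence k i)
  , λ k i (d , dUnder≡d , i≤d) → Abar-recurrence k i (ℕₚ.≤-trans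
      (ℤₚ.drop‿+≤+ (ℤₚ.≤-trans i≤d (dUnder-≤ (k ⊓ J) dUnder≡d))) (ℕₚ.m⊓n≤m k J))
  where open PathSums L J Q
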